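{- Let $\mathcal{A}=\{(-1,1),(1,1),(1,-1)\}$. Then $$Q_{\mathcal{A}}(x,0,\pm\tfrac12)=\sum_{n\ge0}\frac{T_n}{4^n}x^{2n},$$ where $(T_n)_{n\ge0}=(1,2,16,272,7936,\dots)$ are the tangent numbers. Equivalently, $$Q_{\mathcal{A}}(x,0,\tfrac12)=2\sum_{n\ge0}(2^{2n+2}-1)\frac{(-1)^n}{n+1}B_{2n+2}\,x^{2n},$$ where $(B_n)_{n\ge0}$ are the Bernoulli numbers.
   Context: $\#_{\mathcal{A}}\{(0,0)\stackrel{n}{\to}(i,j)\}$ is the number of walks of length $n$ with steps in $\mathcal{A}$, from $(0,0)$ to $(i,j)$, all of whose points lie in $\mathbb{N}^2$; $Q_{\mathcal{A}}(x,y,t)=\sum_{i,j,n\ge0}\#_{\mathcal{A}}\{(0,0)\stackrel{n}{\to}(i,j)\}x^iy^jt^n$, and $Q_{\mathcal{A}}(x,0,\pm\tfrac12)\in\mathbb{R}[[x]]$ is obtained by summing, for each $i$, the (convergent) series in $t$ at $t=\pm\tfrac12$. Tangent numbers: $\tan x=\sum_{n\ge0}T_n\frac{x^{2n+1}}{(2n+1)!}$. Bernoulli numbers: $\sum_{n\ge0}B_n\frac{x^n}{n!}=\frac{x}{e^x-1}$. -}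

module Defs where

open import Data.Nat as ℕ using (ℕ; zero; suc)
open import Data.Nat.Base using (_!)
open import Data.Nat.Properties using (_!≢0)
open import Data.Integer as ℤ using (ℤ; +_; -[1+_])
open import Data.Rational as ℚ using (ℚ; 0ℚ; 1ℚ; ½; _+_; _*_; _-_; _<_; ∣_∣)
open import Data.Bool using (Bool; true; false; _∧_)
open import Data.List using (List; []; _∷_; length; filter; map; concatMap)
open import Data.Product using (_×_; _,_; ∃-syntax)
open import Relation.Binary.PropositionalEquality using (_≡_)
open import Relation.Nullary.Decidable using (does)
open import Data.Nat.Base using (_≤_)
open import Function using (_∘_)

data Step : Set where
  NW NE SE : Step

stepX stepY : Step → ℤ
stepX NW = ℤ.- (+ 1)
stepX NE = + 1
stepX SE = + 1
stepY NW = + 1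
stepY NE = + 1
stepY SE = ℤ.- (+ 1)

allWords : ℕ → List (List Step)
allWords zero    = [] ∷ []
allWords (suc n) = concatMap (λ w → (NW ∷ w) ∷ (NE ∷ w) ∷ (SE ∷ w) ∷ []) (allWords n)

nonneg : ℤ → Bool
nonneg (+ _)     = true
nonneg -[1+ _ ]  = false

validFrom : ℤ → ℤ → List Step → ℕ → ℕ → Bool
validFrom x y []      i j = does (x ℤ.≟ + i) ∧ does (y ℤ.≟ + j)
validFrom x y (s ∷ w) i j =
  let x' = x ℤ.+ stepX s ; y' = y ℤ.+ stepY s in
  nonneg x' ∧ nonneg y' ∧ validFrom x' y' w i j

walkCount : ℕ → ℕ → ℕ → ℕ
walkCount n i j = length (filter (λ w → Data.Bool._≟_ (validFrom (+ 0) (+ 0) w i j) true) (allWords n))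
  where import Data.Bool

_^ℚ_ : ℚ → ℕ → ℚ
q ^ℚ zero  = 1ℚ
q ^ℚ suc n = q * (q ^ℚ n)

fromℕ : ℕ → ℚ
fromℕ n = + n ℚ./ 1

inv! : ℕ → ℚ
inv! n = (+ 1 ℚ./ (n !)) {{n !≢0}}

sign : ℕ → ℚ
sign zero    = 1ℚ
sign (suc m) = ℚ.- sign m

Σ≤ : ℕ → (ℕ → ℚ) → ℚ
Σ≤ zero    f = f 0
Σ≤ (suc n) f = Σ≤ n f + f (suc n)

Σ< : ℕ → (ℕ → ℚ) → ℚ
Σ< zero    f = 0ℚ
Σ< (suc n) f = Σ< n f + f n

SeriesConvergesTo : (ℕ → ℚ) → ℚ → Set
SeriesConvergesTo a L =
  ∀ (ε : ℚ) → 0ℚ < ε → ∃[ N ] (∀ M → N ≤ M → ∣ Σ< M a - L ∣ < ε)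

evenN : ℕ → Bool
evenN zero = true
evenN (suc zero) = false
evenN (suc (suc n)) = evenN n

half : ℕ → ℕ
half zero = zero
half (suc zero) = zero
half (suc (suc n)) = suc (half n)

cosCoeff : ℕ → ℚ
cosCoeff k with evenN k
... | true  = sign (half k) * inv! k
... | false = 0ℚ

sinCoeff : ℕ → ℚ
sinCoeff k with evenN k
... | true  = 0ℚ
... | false = sign (half k) * inv! k

expm1Coeff : ℕ → ℚ
expm1Coeff zero    = 0ℚ
expm1Coeff (suc k) = inv! (suc k)

xCoeff : ℕ → ℚ
xCoeff (suc zero) = 1ℚ
xCoeff _          = 0ℚ

-- a is the coefficient sequence of tan x = sin x / cos x,
-- i.e. cos x · (Σ a_k x^k) = sin x as formal power series
IsTanSeries : (ℕ → ℚ) → Set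
IsTanSeries a = ∀ k → Σ≤ k (λ j → cosCoeff j * a (k ℕ.∸ j)) ≡ sinCoeff k

-- b n = B_n / n!, i.e. Σ b_n x^n = x / (e^x - 1),
-- i.e. (e^x - 1) · (Σ b_n x^n) = x as formal power series
IsBernoulliEGF : (ℕ → ℚ) → Set
IsBernoulliEGF b = ∀ k → Σ≤ k (λ j → expm1Coeff j * b (k ℕ.∸ j)) ≡ xCoeff k

tangentNumber : (ℕ → ℚ) → ℕ → ℚ
tangentNumber a n = fromℕ ((suc (2 ℕ.* n)) !) * a (suc (2 ℕ.* n))

bernoulliNumber : (ℕ → ℚ) → ℕ → ℚ
bernoulliNumber b n = fromℕ (n !) * b n

-- Coefficient of x^i in Q_A(x,0,t): the series Σ_n #{(0,0)→(i,0)} t^n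

QTerm : ℚ → ℕ → ℕ → ℚ
QTerm t i n = fromℕ (walkCount n i 0) * (t ^ℚ n)

tanForm : (ℕ → ℚ) → ℕ → ℚ
tanForm a i with evenN i
... | true  = tangentNumber a (half i) * ((+ 1 ℚ./ 4) ^ℚ half i)
... | false = 0ℚ

bernForm : (ℕ → ℚ) → ℕ → ℚ
bernForm b i with evenN i
... | true  = let n = half i in
              fromℕ 2 * (fromℕ (2 ℕ.^ (2 ℕ.* n ℕ.+ 2)) - 1ℚ) * sign n
                * (+ 1 ℚ./ suc n) * bernoulliNumber b (2 ℕ.* n ℕ.+ 2)
... | false = 0ℚ

-- For t = 1/2 the series G(p, q) = Σₙ #(walks of length n from (0,0) to (p,q)) tⁿ satisfies
-- G = δ₍₀,₀₎ + ½ · (sum of G over the predecessors of (p, q)). Conversely, every solution G of this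
-- equation is that series: G(I, 0) minus the M-th partial sum is ½ᴹ times the M-fold predecessor sum of G
-- at (I, 0), which only involves the triangle p + q ≤ I, and there the predecessor sum maps the positive
-- potential K^(p+q) (p+1) (q+1), K = I + 1, to at most (2 - 1/K²) times itself.
-- On the antidiagonal p + q = 2k a solution is
--   G(p, q) = 4⁻ᵏ Σⱼ (-4)ʲ C(q+1, 2j+1) T_{k-j},
-- harmonic by Pascal's rule and by Σⱼ (-4)ʲ C(2k+2, 2j+1) T_{k-j} = 2 (-4)ᵏ, the coefficient of x^(2k+2)
-- in sinh 2x · tanh x = cosh 2x - 1; on the axis q = 0 it is T_k / 4ᵏ. Walks of odd length never end on
-- the axis, so t = -1/2 gives the same series, and x tanh x = 2x coth 2x - x coth x turns the tangent
-- numbers into Bernoulli numbers.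

module Submission where

open import Defs
open import Data.Nat using (ℕ)
open import Data.Rational using (ℚ; ½; -½)
open import Data.Product using (_×_)
open import Data.Product using (_,_)
open import Relation.Binary.PropositionalEquality using (subst)

module RationalRingSolver where

  open import Data.Rational using (0ℚ)
  open import Data.Rational.Properties using (+-*-commutativeRing; _≟_)
  open import Level using (0ℓ)
  open import Relation.Nullary.Decidable.Core using (dec⇒maybe)
  open import Tactic.RingSolver.Core.AlmostCommutativeRing using (AlmostCommutativeRing; fromCommutativeRing)
  open import Tactic.RingSolver using (solve-∀) public

  ℚ-ring : AlmostCommutativeRing 0ℓ 0ℓ
  ℚ-ring = fromCommutativeRing +-*-commutativeRing (λ x → dec⇒maybe (0ℚ ≟ x))

module Parity where

  open import Data.Bool using (true; false)
  open import Data.Nat using (ℕ; zero; suc; _+_; _*_; _∸_; _≤_; s≤s)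
  open import Data.Nat.Properties using (+-suc)
  open import Relation.Binary.PropositionalEquality

  dbl : ℕ → ℕ
  dbl zero    = zero
  dbl (suc n) = suc (suc (dbl n))

  data Parity : ℕ → Set where
    even : ∀ i → Parity (dbl i)
    odd  : ∀ i → Parity (suc (dbl i))

  parity : ∀ n → Parity n
  parity zero = even 0
  parity (suc n) with parity n
  ... | even i = odd i
  ... | odd i  = even (suc i)

  evenN-dbl : ∀ i → evenN (dbl i) ≡ true
  evenN-dbl zero    = refl
  evenN-dbl (suc i) = evenN-dbl i

  evenN-suc-dbl : ∀ i → evenN (suc (dbl i)) ≡ false
  evenN-suc-dbl zero    = refl
  evenN-suc-dbl (suc i) = evenN-suc-dbl i

  half-dbl : ∀ i → half (dbl i) ≡ i
  half-dbl zero    = refl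
  half-dbl (suc i) = cong suc (half-dbl i)

  half-suc-dbl : ∀ i → half (suc (dbl i)) ≡ i
  half-suc-dbl zero    = refl
  half-suc-dbl (suc i) = cong suc (half-suc-dbl i)

  half-dbl-+ : ∀ i n → half (dbl i + n) ≡ i + half n
  half-dbl-+ zero    n = refl
  half-dbl-+ (suc i) n = cong suc (half-dbl-+ i n)

  dbl≡2* : ∀ n → dbl n ≡ 2 * n
  dbl≡2* zero    = refl
  dbl≡2* (suc n) = trans (cong (λ k → suc (suc k)) (dbl≡2* n)) (cong suc (sym (+-suc n (n + 0))))

  suc-dbl-∸-dbl : ∀ {j k} → j ≤ k → suc (dbl k) ∸ dbl j ≡ suc (dbl (k ∸ j))
  suc-dbl-∸-dbl {zero}  {k}     _         = refl
  suc-dbl-∸-dbl {suc j} {suc k} (s≤s j≤k) = suc-dbl-∸-dbl j≤k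

  suc-dbl-+-suc-dbl : ∀ {j k} → j ≤ k → suc (dbl j) + suc (dbl (k ∸ j)) ≡ dbl (suc k)
  suc-dbl-+-suc-dbl {zero}  {k}     _         = refl
  suc-dbl-+-suc-dbl {suc j} {suc k} (s≤s j≤k) = cong (λ n → suc (suc n)) (suc-dbl-+-suc-dbl j≤k)

module Binomial where

  open import Data.Nat using (zero; suc; _+_; _*_; _^_; _∸_; _≤_; _!)
  open import Data.Nat.Properties using (m+n∸m≡n; m≤m+n; _!*_!≢0; ≤-reflexive; ≤-trans; *-monoʳ-≤; module ≤-Reasoning)
  open import Data.Nat.Combinatorics using (_C_; nCk≡n!/k![n-k]!; k![n∸k]!∣n!; nCk+nC[k+1]≡[n+1]C[k+1]; nC1≡n)
  open import Data.Nat.Tactic.RingSolver using (solve-∀)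
  open import Data.Nat.DivMod using (m/n*n≡m)
  open import Relation.Binary.PropositionalEquality

  nCk*k!*[n∸k]!≡n! : ∀ {n k} → k ≤ n → (n C k) * (k ! * (n ∸ k) !) ≡ n !
  nCk*k!*[n∸k]!≡n! {n} {k} k≤n =
    trans (cong (_* (k ! * (n ∸ k) !)) (nCk≡n!/k![n-k]! k≤n)) (m/n*n≡m {{k !* (n ∸ k) !≢0}} (k![n∸k]!∣n! k≤n))

  [m+n]Cm*m!*n!≡[m+n]! : ∀ m n → ((m + n) C m) * (m ! * n !) ≡ (m + n) !
  [m+n]Cm*m!*n!≡[m+n]! m n =
    subst (λ r → ((m + n) C m) * (m ! * r !) ≡ (m + n) !) (m+n∸m≡n m n) (nCk*k!*[n∸k]!≡n! (m≤m+n m n))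

  C-second-difference : ∀ c r → suc (suc c) C suc (suc r) + c C suc (suc r) ≡ 2 * (suc c C suc (suc r)) + c C r
  C-second-difference c r = begin
    suc (suc c) C suc (suc r) + c C suc (suc r)
      ≡⟨ cong (_+ c C suc (suc r)) (nCk+nC[k+1]≡[n+1]C[k+1] (suc c) (suc r)) ⟨
    (suc c C suc r + suc c C suc (suc r)) + c C suc (suc r)
      ≡⟨ cong₂ (λ x y → (x + y) + c C suc (suc r)) (nCk+nC[k+1]≡[n+1]C[k+1] c r) (nCk+nC[k+1]≡[n+1]C[k+1] c (suc r)) ⟨
    ((c C r + c C suc r) + (c C suc r + c C suc (suc r))) + c C suc (suc r)
      ≡⟨ regroup (c C r) (c C suc r) (c C suc (suc r)) ⟩
    2 * (c C suc r + c C suc (suc r)) + c C r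
      ≡⟨ cong (λ x → 2 * x + c C r) (nCk+nC[k+1]≡[n+1]C[k+1] c (suc r)) ⟩
    2 * (suc c C suc (suc r)) + c C r
      ∎
    where
    open ≡-Reasoning
    regroup : ∀ x y z → ((x + y) + (y + z)) + z ≡ 2 * (y + z) + x
    regroup = solve-∀

  C-second-difference-1 : ∀ c → suc (suc c) C 1 + c C 1 ≡ 2 * (suc c C 1)
  C-second-difference-1 c rewrite nC1≡n (suc (suc c)) | nC1≡n c | nC1≡n (suc c) = twice c
    where
    twice : ∀ c → suc (suc c) + c ≡ 2 * suc c
    twice = solve-∀

  bernoulli-inequality : ∀ d M → d ^ M * (suc d + M) ≤ suc d ^ suc M
  bernoulli-inequality d zero    = ≤-reflexive (identity d)
    where
    identity : ∀ d → 1 * (suc d + 0) ≡ suc d * 1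
    identity = solve-∀
  bernoulli-inequality d (suc M) = begin
    d * d ^ M * (suc d + suc M)          ≡⟨ regroup d (d ^ M) M ⟩
    d ^ M * (d * (suc d + suc M))        ≤⟨ *-monoʳ-≤ (d ^ M) (≤-trans (m≤m+n _ (suc M)) (≤-reflexive (expand d M))) ⟩
    d ^ M * (suc d * (suc d + M))        ≡⟨ swap (d ^ M) (suc d) (suc d + M) ⟩
    suc d * (d ^ M * (suc d + M))        ≤⟨ *-monoʳ-≤ (suc d) (bernoulli-inequality d M) ⟩
    suc d * suc d ^ suc M                ∎
    where
    open ≤-Reasoning
    regroup : ∀ d p M → d * p * (suc d + suc M) ≡ p * (d * (suc d + suc M))
    regroup = solve-∀
    expand : ∀ d M → d * (suc d + suc M) + suc M ≡ suc d * (suc d + M)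
    expand = solve-∀
    swap : ∀ p s t → p * (s * t) ≡ s * (p * t)
    swap = solve-∀

module FiniteSums where

  open import Data.Nat as ℕ using (ℕ; zero; suc; _∸_; z≤n; s≤s)
  import Data.Nat.Properties as ℕ
  open import Data.Rational using (ℚ; 0ℚ; _+_; _*_; _≤_)
  open import Data.Rational.Properties
  open import Data.Sum using (inj₁; inj₂)
  open import Relation.Binary.PropositionalEquality
  open RationalRingSolver using (solve-∀; ℚ-ring)
  open Parity using (dbl)
  open ≡-Reasoning

  Σ≤-cong : ∀ n {f g : ℕ → ℚ} → (∀ j → f j ≡ g j) → Σ≤ n f ≡ Σ≤ n g
  Σ≤-cong zero    f≡g = f≡g 0
  Σ≤-cong (suc n) f≡g = cong₂ _+_ (Σ≤-cong n f≡g) (f≡g (suc n))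

  Σ≤-cong-≤ : ∀ n {f g : ℕ → ℚ} → (∀ j → j ℕ.≤ n → f j ≡ g j) → Σ≤ n f ≡ Σ≤ n g
  Σ≤-cong-≤ zero    f≡g = f≡g 0 z≤n
  Σ≤-cong-≤ (suc n) f≡g =
    cong₂ _+_ (Σ≤-cong-≤ n (λ j j≤n → f≡g j (ℕ.m≤n⇒m≤1+n j≤n))) (f≡g (suc n) ℕ.≤-refl)

  Σ≤-zero : ∀ n → Σ≤ n (λ _ → 0ℚ) ≡ 0ℚ
  Σ≤-zero zero    = refl
  Σ≤-zero (suc n) = cong (_+ 0ℚ) (Σ≤-zero n)

  Σ≤-+ : ∀ n (f g : ℕ → ℚ) → Σ≤ n (λ j → f j + g j) ≡ Σ≤ n f + Σ≤ n g
  Σ≤-+ zero    f g = refl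
  Σ≤-+ (suc n) f g = trans (cong (_+ (f (suc n) + g (suc n))) (Σ≤-+ n f g)) (swap (Σ≤ n f) (Σ≤ n g) (f (suc n)) (g (suc n)))
    where
    swap : ∀ a b c d → (a + b) + (c + d) ≡ (a + c) + (b + d)
    swap = solve-∀ ℚ-ring

  Σ≤-*ˡ : ∀ n c (f : ℕ → ℚ) → Σ≤ n (λ j → c * f j) ≡ c * Σ≤ n f
  Σ≤-*ˡ zero    c f = refl
  Σ≤-*ˡ (suc n) c f = trans (cong (_+ c * f (suc n)) (Σ≤-*ˡ n c f)) (sym (*-distribˡ-+ c _ _))

  Σ≤-*ʳ : ∀ n c (f : ℕ → ℚ) → Σ≤ n (λ j → f j * c) ≡ Σ≤ n f * c
  Σ≤-*ʳ n c f = trans (Σ≤-cong n (λ j → *-comm (f j) c)) (trans (Σ≤-*ˡ n c f) (*-comm c _))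

  Σ≤-head : ∀ n (f : ℕ → ℚ) → Σ≤ (suc n) f ≡ f 0 + Σ≤ n (λ j → f (suc j))
  Σ≤-head zero    f = refl
  Σ≤-head (suc n) f = trans (cong (_+ f (suc (suc n))) (Σ≤-head n f)) (+-assoc (f 0) _ _)

  Σ≤-reverse : ∀ n (f : ℕ → ℚ) → Σ≤ n f ≡ Σ≤ n (λ j → f (n ∸ j))
  Σ≤-reverse zero    f = refl
  Σ≤-reverse (suc n) f = begin
    Σ≤ n f + f (suc n)                    ≡⟨ cong (_+ f (suc n)) (Σ≤-reverse n f) ⟩
    Σ≤ n (λ j → f (n ∸ j)) + f (suc n)    ≡⟨ +-comm _ (f (suc n)) ⟩
    f (suc n) + Σ≤ n (λ j → f (n ∸ j))    ≡⟨ Σ≤-head n (λ j → f (suc n ∸ j)) ⟨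
    Σ≤ (suc n) (λ j → f (suc n ∸ j))      ∎

  Σ≤-triangle : ∀ n (φ : ℕ → ℕ → ℚ) →
    Σ≤ n (λ j → Σ≤ j (λ i → φ i j)) ≡ Σ≤ n (λ i → Σ≤ (n ∸ i) (λ l → φ i (i ℕ.+ l)))
  Σ≤-triangle zero    φ = refl
  Σ≤-triangle (suc n) φ = begin
    Σ≤ n (λ j → Σ≤ j (λ i → φ i j)) + (Σ≤ n (λ i → φ i (suc n)) + φ (suc n) (suc n))
      ≡⟨ cong (_+ (Σ≤ n (λ i → φ i (suc n)) + φ (suc n) (suc n))) (Σ≤-triangle n φ) ⟩
    Σ≤ n row + (Σ≤ n (λ i → φ i (suc n)) + φ (suc n) (suc n))
      ≡⟨ +-assoc (Σ≤ n row) (Σ≤ n (λ i → φ i (suc n))) (φ (suc n) (suc n)) ⟨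
    (Σ≤ n row + Σ≤ n (λ i → φ i (suc n))) + φ (suc n) (suc n)
      ≡⟨ cong (_+ φ (suc n) (suc n)) (Σ≤-+ n row (λ i → φ i (suc n))) ⟨
    Σ≤ n (λ i → row i + φ i (suc n)) + φ (suc n) (suc n)
      ≡⟨ cong₂ _+_ (Σ≤-cong-≤ n extend) last ⟩
    Σ≤ n (λ i → Σ≤ (suc n ∸ i) (λ l → φ i (i ℕ.+ l))) + Σ≤ (suc n ∸ suc n) (λ l → φ (suc n) (suc n ℕ.+ l))
      ∎
    where
    row : ℕ → ℚ
    row i = Σ≤ (n ∸ i) (λ l → φ i (i ℕ.+ l))
    extend : ∀ i → i ℕ.≤ n → row i + φ i (suc n) ≡ Σ≤ (suc n ∸ i) (λ l → φ i (i ℕ.+ l))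
    extend i i≤n rewrite ℕ.+-∸-assoc 1 i≤n =
      cong (row i +_) (cong (φ i) (sym (trans (ℕ.+-suc i (n ∸ i)) (cong suc (ℕ.m+[n∸m]≡n i≤n)))))
    last : φ (suc n) (suc n) ≡ Σ≤ (suc n ∸ suc n) (λ l → φ (suc n) (suc n ℕ.+ l))
    last rewrite ℕ.n∸n≡0 n | ℕ.+-identityʳ n = refl

  Σ≤-odd : ∀ k (f : ℕ → ℚ) → (∀ j → f (dbl j) ≡ 0ℚ) → Σ≤ (dbl (suc k)) f ≡ Σ≤ k (λ j → f (suc (dbl j)))
  Σ≤-odd zero    f f-even≡0 = begin
    f 0 + f 1 + f 2      ≡⟨ cong₂ (λ x y → x + f 1 + y) (f-even≡0 0) (f-even≡0 1) ⟩
    0ℚ + f 1 + 0ℚ        ≡⟨ trans (+-identityʳ _) (+-identityˡ (f 1)) ⟩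
    f 1                  ∎
  Σ≤-odd (suc k) f f-even≡0 = begin
    Σ≤ (dbl (suc k)) f + f (suc (dbl (suc k))) + f (dbl (suc (suc k)))
      ≡⟨ cong₂ (λ x y → x + f (suc (dbl (suc k))) + y) (Σ≤-odd k f f-even≡0) (f-even≡0 (suc (suc k))) ⟩
    Σ≤ k (λ j → f (suc (dbl j))) + f (suc (dbl (suc k))) + 0ℚ
      ≡⟨ +-identityʳ _ ⟩
    Σ≤ (suc k) (λ j → f (suc (dbl j)))
      ∎

  Σ≤-nonNeg : ∀ n (f : ℕ → ℚ) → (∀ j → 0ℚ ≤ f j) → 0ℚ ≤ Σ≤ n f
  Σ≤-nonNeg zero    f f≥0 = f≥0 0
  Σ≤-nonNeg (suc n) f f≥0 =
    ≤-trans (≤-reflexive (sym (+-identityʳ 0ℚ))) (+-mono-≤ (Σ≤-nonNeg n f f≥0) (f≥0 (suc n)))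

  term≤Σ≤ : ∀ n (f : ℕ → ℚ) → (∀ j → 0ℚ ≤ f j) → ∀ k → k ℕ.≤ n → f k ≤ Σ≤ n f
  term≤Σ≤ zero    f f≥0 zero _ = ≤-refl
  term≤Σ≤ (suc n) f f≥0 k k≤1+n with ℕ.m≤n⇒m<n∨m≡n k≤1+n
  ... | inj₁ (s≤s k≤n) =
    ≤-trans (≤-trans (term≤Σ≤ n f f≥0 k k≤n) (≤-reflexive (sym (+-identityʳ _))))
            (+-monoʳ-≤ (Σ≤ n f) (f≥0 (suc n)))
  ... | inj₂ refl =
    ≤-trans (≤-reflexive (sym (+-identityˡ _))) (+-monoˡ-≤ (f (suc n)) (Σ≤-nonNeg n f f≥0))

  Σ<-cong : ∀ M {f g : ℕ → ℚ} → (∀ n → f n ≡ g n) → Σ< M f ≡ Σ< M g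
  Σ<-cong zero    f≡g = refl
  Σ<-cong (suc M) f≡g = cong₂ _+_ (Σ<-cong M f≡g) (f≡g M)

  Σ<-*ˡ : ∀ M c (f : ℕ → ℚ) → Σ< M (λ n → c * f n) ≡ c * Σ< M f
  Σ<-*ˡ zero    c f = sym (*-zeroʳ c)
  Σ<-*ˡ (suc M) c f = trans (cong (_+ c * f M) (Σ<-*ˡ M c f)) (sym (*-distribˡ-+ c _ _))

  Σ<-head : ∀ M (f : ℕ → ℚ) → Σ< (suc M) f ≡ f 0 + Σ< M (λ n → f (suc n))
  Σ<-head zero    f = trans (+-identityˡ (f 0)) (sym (+-identityʳ (f 0)))
  Σ<-head (suc M) f = trans (cong (_+ f (suc M)) (Σ<-head M f)) (+-assoc (f 0) _ _)

module Rationals where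

  open import Data.Nat as ℕ using (ℕ; zero; suc; _!)
  import Data.Nat.Properties as ℕ
  open import Data.Integer as ℤ using (1ℤ; -[1+_])
  import Data.Integer.Properties as ℤ
  open import Data.Integer.Tactic.RingSolver as ℤ-Solver using ()
  open import Data.Rational as ℚ
    using (ℚ; mkℚ; 0ℚ; 1ℚ; ½; _+_; _*_; -_; _≤_; _<_; toℚᵘ; NonNegative)
  open import Data.Rational.Properties
  import Data.Rational.Unnormalised as ℚᵘ
  import Data.Rational.Unnormalised.Properties as ℚᵘ
  open import Data.Product using (∃-syntax; _,_)
  open import Relation.Binary.PropositionalEquality
  open RationalRingSolver using (solve-∀; ℚ-ring)
  open Parity using (dbl)
  open import Data.Nat.Combinatorics using (_C_)
  open Binomial using ([m+n]Cm*m!*n!≡[m+n]!)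

  ¼ : ℚ
  ¼ = ℤ.+ 1 ℚ./ 4

  toℚᵘ-fromℕ : ∀ n → toℚᵘ (fromℕ n) ℚᵘ.≃ ℚᵘ.mkℚᵘ (ℤ.+ n) 0
  toℚᵘ-fromℕ n = toℚᵘ-fromℚᵘ (ℚᵘ.mkℚᵘ (ℤ.+ n) 0)

  fromℕ-+ : ∀ m n → fromℕ (m ℕ.+ n) ≡ fromℕ m + fromℕ n
  fromℕ-+ m n = toℚᵘ-injective (ℚᵘ.≃-trans (toℚᵘ-fromℕ (m ℕ.+ n)) (ℚᵘ.≃-trans
    (ℚᵘ.*≡* (integral (ℤ.+ m) (ℤ.+ n)))
    (ℚᵘ.≃-sym (ℚᵘ.≃-trans (toℚᵘ-homo-+ (fromℕ m) (fromℕ n)) (ℚᵘ.+-cong (toℚᵘ-fromℕ m) (toℚᵘ-fromℕ n))))))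
    where
    integral : ∀ x y → (x ℤ.+ y) ℤ.* (1ℤ ℤ.* 1ℤ) ≡ (x ℤ.* 1ℤ ℤ.+ y ℤ.* 1ℤ) ℤ.* 1ℤ
    integral = ℤ-Solver.solve-∀

  fromℕ-suc : ∀ n → fromℕ (suc n) ≡ 1ℚ + fromℕ n
  fromℕ-suc = fromℕ-+ 1

  fromℕ-* : ∀ m n → fromℕ (m ℕ.* n) ≡ fromℕ m * fromℕ n
  fromℕ-* zero    n = sym (*-zeroˡ (fromℕ n))
  fromℕ-* (suc m) n = begin
    fromℕ (n ℕ.+ m ℕ.* n)          ≡⟨ fromℕ-+ n (m ℕ.* n) ⟩
    fromℕ n + fromℕ (m ℕ.* n)      ≡⟨ cong (fromℕ n +_) (fromℕ-* m n) ⟩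
    fromℕ n + fromℕ m * fromℕ n    ≡⟨ factor (fromℕ m) (fromℕ n) ⟩
    (1ℚ + fromℕ m) * fromℕ n       ≡⟨ cong (_* fromℕ n) (fromℕ-suc m) ⟨
    fromℕ (suc m) * fromℕ n        ∎
    where
    open ≡-Reasoning
    factor : ∀ a b → b + a * b ≡ (1ℚ + a) * b
    factor = solve-∀ ℚ-ring

  fromℕ-^ : ∀ x m → fromℕ (x ℕ.^ m) ≡ fromℕ x ^ℚ m
  fromℕ-^ x zero    = refl
  fromℕ-^ x (suc m) = trans (fromℕ-* x (x ℕ.^ m)) (cong (fromℕ x *_) (fromℕ-^ x m))

  1/n*n≡1 : ∀ n .{{_ : ℕ.NonZero n}} → (ℤ.+ 1 ℚ./ n) * fromℕ n ≡ 1ℚ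
  1/n*n≡1 (suc k) = toℚᵘ-injective (ℚᵘ.≃-trans (toℚᵘ-homo-* (ℤ.+ 1 ℚ./ suc k) (fromℕ (suc k)))
    (ℚᵘ.≃-trans (ℚᵘ.*-cong (toℚᵘ-fromℚᵘ (ℚᵘ.mkℚᵘ (ℤ.+ 1) k)) (toℚᵘ-fromℕ (suc k))) (ℚᵘ.*≡* (integral (ℤ.+ suc k)))))
    where
    integral : ∀ x → (1ℤ ℤ.* x) ℤ.* 1ℤ ≡ 1ℤ ℤ.* (x ℤ.* 1ℤ)
    integral = ℤ-Solver.solve-∀

  inv!*!≡1 : ∀ n → inv! n * fromℕ (n !) ≡ 1ℚ
  inv!*!≡1 n = 1/n*n≡1 (n !) {{n ℕ.!≢0}}

  inverse-unique : ∀ {x y} c → x * c ≡ 1ℚ → y * c ≡ 1ℚ → x ≡ y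
  inverse-unique {x} {y} c x*c≡1 y*c≡1 = begin
    x              ≡⟨ *-identityʳ x ⟨
    x * 1ℚ         ≡⟨ cong (x *_) y*c≡1 ⟨
    x * (y * c)    ≡⟨ reassoc x y c ⟩
    (x * c) * y    ≡⟨ cong (_* y) x*c≡1 ⟩
    1ℚ * y         ≡⟨ *-identityˡ y ⟩
    y              ∎
    where
    open ≡-Reasoning
    reassoc : ∀ x y c → x * (y * c) ≡ (x * c) * y
    reassoc = solve-∀ ℚ-ring

  *-cancelˡ-invertible : ∀ u {c x y} → u * c ≡ 1ℚ → c * x ≡ c * y → x ≡ y
  *-cancelˡ-invertible u {c} {x} {y} u*c≡1 cx≡cy = begin
    x              ≡⟨ *-identityˡ x ⟨
    1ℚ * x         ≡⟨ cong (_* x) u*c≡1 ⟨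
    (u * c) * x    ≡⟨ *-assoc u c x ⟩
    u * (c * x)    ≡⟨ cong (u *_) cx≡cy ⟩
    u * (c * y)    ≡⟨ *-assoc u c y ⟨
    (u * c) * y    ≡⟨ cong (_* y) u*c≡1 ⟩
    1ℚ * y         ≡⟨ *-identityˡ y ⟩
    y              ∎
    where open ≡-Reasoning

  *-cancelˡ-fromℕ-suc : ∀ n {x y} → fromℕ (suc n) * x ≡ fromℕ (suc n) * y → x ≡ y
  *-cancelˡ-fromℕ-suc n = *-cancelˡ-invertible (ℤ.+ 1 ℚ./ suc n) (1/n*n≡1 (suc n))

  inv!-suc : ∀ n → inv! (suc n) * fromℕ (suc n) ≡ inv! n
  inv!-suc n = inverse-unique (fromℕ (n !)) (begin
    inv! (suc n) * fromℕ (suc n) * fromℕ (n !)      ≡⟨ *-assoc (inv! (suc n)) _ _ ⟩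
    inv! (suc n) * (fromℕ (suc n) * fromℕ (n !))    ≡⟨ cong (inv! (suc n) *_) (fromℕ-* (suc n) (n !)) ⟨
    inv! (suc n) * fromℕ (suc n ! )                  ≡⟨ inv!*!≡1 (suc n) ⟩
    1ℚ                                               ∎) (inv!*!≡1 n)
    where open ≡-Reasoning

  [m+n]Cm*n!≡[m+n]!*inv!m : ∀ m n → fromℕ ((m ℕ.+ n) C m) * fromℕ (n !) ≡ fromℕ ((m ℕ.+ n) !) * inv! m
  [m+n]Cm*n!≡[m+n]!*inv!m m n = begin
    binom * fromℕ (n !)                              ≡⟨ *-identityʳ _ ⟨
    binom * fromℕ (n !) * 1ℚ                         ≡⟨ cong (binom * fromℕ (n !) *_) (trans (*-comm (fromℕ (m !)) (inv! m)) (inv!*!≡1 m)) ⟨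
    binom * fromℕ (n !) * (fromℕ (m !) * inv! m)     ≡⟨ regroup binom (fromℕ (n !)) (fromℕ (m !)) (inv! m) ⟩
    binom * (fromℕ (m !) * fromℕ (n !)) * inv! m     ≡⟨ cong (λ x → binom * x * inv! m) (fromℕ-* (m !) (n !)) ⟨
    binom * fromℕ (m ! ℕ.* n !) * inv! m             ≡⟨ cong (_* inv! m) (fromℕ-* ((m ℕ.+ n) C m) (m ! ℕ.* n !)) ⟨
    fromℕ (((m ℕ.+ n) C m) ℕ.* (m ! ℕ.* n !)) * inv! m  ≡⟨ cong (λ k → fromℕ k * inv! m) ([m+n]Cm*m!*n!≡[m+n]! m n) ⟩
    fromℕ ((m ℕ.+ n) !) * inv! m                 ∎
    where
    open ≡-Reasoning
    binom = fromℕ ((m ℕ.+ n) C m)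
    regroup : ∀ c f g i → c * f * (g * i) ≡ c * (g * f) * i
    regroup = solve-∀ ℚ-ring

  1^ℚn≡1 : ∀ n → 1ℚ ^ℚ n ≡ 1ℚ
  1^ℚn≡1 zero    = refl
  1^ℚn≡1 (suc n) = trans (*-identityˡ _) (1^ℚn≡1 n)

  ^ℚ-+ : ∀ p m n → p ^ℚ (m ℕ.+ n) ≡ p ^ℚ m * p ^ℚ n
  ^ℚ-+ p zero    n = sym (*-identityˡ _)
  ^ℚ-+ p (suc m) n = trans (cong (p *_) (^ℚ-+ p m n)) (sym (*-assoc p _ _))

  ^ℚ-distrib-* : ∀ p q n → (p * q) ^ℚ n ≡ p ^ℚ n * q ^ℚ n
  ^ℚ-distrib-* p q zero    = refl
  ^ℚ-distrib-* p q (suc n) = trans (cong ((p * q) *_) (^ℚ-distrib-* p q n)) (interchange p q _ _)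
    where
    interchange : ∀ p q a b → (p * q) * (a * b) ≡ (p * a) * (q * b)
    interchange = solve-∀ ℚ-ring

  ½^n*2^n≡1 : ∀ n → ½ ^ℚ n * fromℕ (2 ℕ.^ n) ≡ 1ℚ
  ½^n*2^n≡1 n = begin
    ½ ^ℚ n * fromℕ (2 ℕ.^ n)      ≡⟨ cong (½ ^ℚ n *_) (fromℕ-^ 2 n) ⟩
    ½ ^ℚ n * fromℕ 2 ^ℚ n         ≡⟨ ^ℚ-distrib-* ½ (fromℕ 2) n ⟨
    (½ * fromℕ 2) ^ℚ n            ≡⟨ 1^ℚn≡1 n ⟩
    1ℚ                            ∎
    where open ≡-Reasoning

  0≤½^n : ∀ n → 0ℚ ≤ ½ ^ℚ n
  0≤½^n zero    = nonNegative⁻¹ 1ℚ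
  0≤½^n (suc n) = nonNegative⁻¹ (½ * ½ ^ℚ n) {{nonNeg*nonNeg⇒nonNeg ½ (½ ^ℚ n) {{ℚ.nonNegative (0≤½^n n)}}}}

  sign-+ : ∀ m n → sign (m ℕ.+ n) ≡ sign m * sign n
  sign-+ zero    n = sym (*-identityˡ (sign n))
  sign-+ (suc m) n = trans (cong -_ (sign-+ m n)) (neg-distribˡ-* (sign m) (sign n))

  sign*sign≡1 : ∀ n → sign n * sign n ≡ 1ℚ
  sign*sign≡1 zero    = refl
  sign*sign≡1 (suc n) = trans (neg*neg (sign n)) (sign*sign≡1 n)
    where
    neg*neg : ∀ x → (- x) * (- x) ≡ x * x
    neg*neg = solve-∀ ℚ-ring

  sign-dbl : ∀ i → sign (dbl i) ≡ 1ℚ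
  sign-dbl zero    = refl
  sign-dbl (suc i) = trans (neg-involutive (sign (dbl i))) (sign-dbl i)
    where
    neg-involutive : ∀ x → - (- x) ≡ x
    neg-involutive = solve-∀ ℚ-ring

  ^ℚ-dbl : ∀ c i → c ^ℚ dbl i ≡ (c * c) ^ℚ i
  ^ℚ-dbl c zero    = refl
  ^ℚ-dbl c (suc i) = trans (sym (*-assoc c c _)) (cong ((c * c) *_) (^ℚ-dbl c i))

  -x^ℚn≡sign*x^ℚn : ∀ x n → (- x) ^ℚ n ≡ sign n * x ^ℚ n
  -x^ℚn≡sign*x^ℚn x zero    = refl
  -x^ℚn≡sign*x^ℚn x (suc n) = trans (cong ((- x) *_) (-x^ℚn≡sign*x^ℚn x n)) (swap-sign x (sign n) (x ^ℚ n))
    where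
    swap-sign : ∀ x s p → (- x) * (s * p) ≡ (- s) * (x * p)
    swap-sign = solve-∀ ℚ-ring

  0≤fromℕ : ∀ n → 0ℚ ≤ fromℕ n
  0≤fromℕ n = nonNegative⁻¹ (fromℕ n) {{normalize-nonNeg n 1}}

  fromℕ-mono-≤ : ∀ {m n} → m ℕ.≤ n → fromℕ m ≤ fromℕ n
  fromℕ-mono-≤ {m} {n} m≤n = begin
    fromℕ m                       ≡⟨ +-identityʳ (fromℕ m) ⟨
    fromℕ m + 0ℚ                  ≤⟨ +-monoʳ-≤ (fromℕ m) (0≤fromℕ (n ℕ.∸ m)) ⟩
    fromℕ m + fromℕ (n ℕ.∸ m)     ≡⟨ fromℕ-+ m (n ℕ.∸ m) ⟨
    fromℕ (m ℕ.+ (n ℕ.∸ m))       ≡⟨ cong fromℕ (ℕ.m+[n∸m]≡n m≤n) ⟩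
    fromℕ n                       ∎
    where open ≤-Reasoning

  archimedean : ∀ x → ∃[ N ] x < fromℕ N
  archimedean (mkℚ (ℤ.+ n) d _) = suc n , toℚᵘ-cancel-< (ℚᵘ.<-respʳ-≃ (ℚᵘ.≃-sym (toℚᵘ-fromℕ (suc n))) (ℚᵘ.*<* n*1<[1+n]*[1+d]))
    where
    n*1<[1+n]*[1+d] : (ℤ.+ n) ℤ.* 1ℤ ℤ.< (ℤ.+ suc n) ℤ.* (ℤ.+ suc d)
    n*1<[1+n]*[1+d] = subst₂ ℤ._<_ (ℤ.pos-* n 1) (ℤ.pos-* (suc n) (suc d))
      (ℤ.+<+ (ℕ.<-≤-trans (subst (ℕ._< suc n) (sym (ℕ.*-identityʳ n)) (ℕ.n<1+n n)) (ℕ.m≤m*n (suc n) (suc d))))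
  archimedean (mkℚ -[1+ n ] d _) = 1 , toℚᵘ-cancel-< (ℚᵘ.<-respʳ-≃ (ℚᵘ.≃-sym (toℚᵘ-fromℕ 1)) (ℚᵘ.*<* ℤ.-<+))

module PowerSeries where

  open import Level using (0ℓ)
  open import Algebra.Bundles using (CommutativeRing)
  open import Algebra.Structures using (IsCommutativeRing)
  import Algebra.Solver.Ring.AlmostCommutativeRing as ACR
  open import Data.Nat as ℕ using (ℕ; zero; suc; _∸_)
  import Data.Nat.Properties as ℕ
  open import Data.Maybe using (Maybe; just; nothing)
  open import Data.Product using (_,_)
  open import Data.Rational using (ℚ; 0ℚ; 1ℚ; _+_; _*_; -_)
  import Data.Rational.Properties as ℚ
  open import Data.Sum using (inj₁; inj₂)
  open import Relation.Binary.Structures using (IsEquivalence)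
  open import Relation.Binary.PropositionalEquality
  import Relation.Binary.Reasoning.Setoid as SetoidReasoning
  open import Relation.Nullary using (yes; no)
  open RationalRingSolver using (solve-∀; ℚ-ring)
  open FiniteSums
  open Rationals using (^ℚ-+)

  Ser : Set
  Ser = ℕ → ℚ

  infix  4 _≈ₛ_
  infixl 6 _⊕_
  infixl 7 _⋆_
  infix  8 ⊝_

  _≈ₛ_ : Ser → Ser → Set
  f ≈ₛ g = ∀ n → f n ≡ g n

  _⊕_ : Ser → Ser → Ser
  (f ⊕ g) n = f n + g n

  ⊝_ : Ser → Ser
  (⊝ f) n = - f n

  _⋆_ : Ser → Ser → Ser
  (f ⋆ g) n = Σ≤ n (λ j → f j * g (n ∸ j))

  κ : ℚ → Ser
  κ c zero    = c
  κ c (suc _) = 0ℚ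

  0ₛ 1ₛ : Ser
  0ₛ _ = 0ℚ
  1ₛ   = κ 1ℚ

  ⋆-cong : ∀ {f f′ g g′} → f ≈ₛ f′ → g ≈ₛ g′ → f ⋆ g ≈ₛ f′ ⋆ g′
  ⋆-cong f≈f′ g≈g′ n = Σ≤-cong n (λ j → cong₂ _*_ (f≈f′ j) (g≈g′ (n ∸ j)))

  ⋆-congˡ : ∀ f {g g′} → g ≈ₛ g′ → f ⋆ g ≈ₛ f ⋆ g′
  ⋆-congˡ f = ⋆-cong {f} {f} (λ _ → refl)

  ⋆-congʳ : ∀ h {f f′} → f ≈ₛ f′ → f ⋆ h ≈ₛ f′ ⋆ h
  ⋆-congʳ h f≈f′ = ⋆-cong {g = h} {h} f≈f′ (λ _ → refl)

  ⊕-cong : ∀ {f f′ g g′} → f ≈ₛ f′ → g ≈ₛ g′ → f ⊕ g ≈ₛ f′ ⊕ g′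
  ⊕-cong f≈f′ g≈g′ n = cong₂ _+_ (f≈f′ n) (g≈g′ n)

  ⊕-congʳ : ∀ h {f f′} → f ≈ₛ f′ → f ⊕ h ≈ₛ f′ ⊕ h
  ⊕-congʳ h f≈f′ n = cong (_+ h n) (f≈f′ n)

  ⊝-cong : ∀ {f g} → f ≈ₛ g → ⊝ f ≈ₛ ⊝ g
  ⊝-cong f≈g n = cong -_ (f≈g n)

  ⋆-comm : ∀ f g → f ⋆ g ≈ₛ g ⋆ f
  ⋆-comm f g n = trans (Σ≤-reverse n _) (Σ≤-cong-≤ n λ j j≤n →
    trans (cong (λ m → f (n ∸ j) * g m) (ℕ.m∸[m∸n]≡n j≤n)) (ℚ.*-comm (f (n ∸ j)) (g j)))

  ⋆-assoc : ∀ f g h → (f ⋆ g) ⋆ h ≈ₛ f ⋆ (g ⋆ h)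
  ⋆-assoc f g h n = begin
    Σ≤ n (λ j → Σ≤ j (λ i → f i * g (j ∸ i)) * h (n ∸ j))
      ≡⟨ Σ≤-cong n (λ j → Σ≤-*ʳ j (h (n ∸ j)) (λ i → f i * g (j ∸ i))) ⟨
    Σ≤ n (λ j → Σ≤ j (λ i → f i * g (j ∸ i) * h (n ∸ j)))
      ≡⟨ Σ≤-triangle n (λ i j → f i * g (j ∸ i) * h (n ∸ j)) ⟩
    Σ≤ n (λ i → Σ≤ (n ∸ i) (λ l → f i * g ((i ℕ.+ l) ∸ i) * h (n ∸ (i ℕ.+ l))))
      ≡⟨ Σ≤-cong n (λ i → trans (Σ≤-cong (n ∸ i) (reindex i)) (Σ≤-*ˡ (n ∸ i) (f i) _)) ⟩
    Σ≤ n (λ i → f i * Σ≤ (n ∸ i) (λ l → g l * h ((n ∸ i) ∸ l)))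
      ∎
    where
    open ≡-Reasoning
    reindex : ∀ i l → f i * g ((i ℕ.+ l) ∸ i) * h (n ∸ (i ℕ.+ l)) ≡ f i * (g l * h ((n ∸ i) ∸ l))
    reindex i l rewrite ℕ.m+n∸m≡n i l | sym (ℕ.∸-+-assoc n i l) = ℚ.*-assoc (f i) (g l) (h ((n ∸ i) ∸ l))

  ⋆-distribˡ-⊕ : ∀ f g h → f ⋆ (g ⊕ h) ≈ₛ f ⋆ g ⊕ f ⋆ h
  ⋆-distribˡ-⊕ f g h n =
    trans (Σ≤-cong n (λ j → ℚ.*-distribˡ-+ (f j) (g (n ∸ j)) (h (n ∸ j)))) (Σ≤-+ n _ _)

  ⋆-distribʳ-⊕ : ∀ f g h → (g ⊕ h) ⋆ f ≈ₛ g ⋆ f ⊕ h ⋆ f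
  ⋆-distribʳ-⊕ f g h n =
    trans (Σ≤-cong n (λ j → ℚ.*-distribʳ-+ (f (n ∸ j)) (g j) (h j))) (Σ≤-+ n _ _)

  κ⋆f≡c*f : ∀ c f n → (κ c ⋆ f) n ≡ c * f n
  κ⋆f≡c*f c f zero    = refl
  κ⋆f≡c*f c f (suc n) = begin
    Σ≤ (suc n) (λ j → κ c j * f (suc n ∸ j))              ≡⟨ Σ≤-head n _ ⟩
    c * f (suc n) + Σ≤ n (λ j → 0ℚ * f (n ∸ j))            ≡⟨ cong (c * f (suc n) +_) vanish ⟩
    c * f (suc n) + 0ℚ                                    ≡⟨ ℚ.+-identityʳ _ ⟩
    c * f (suc n)                                         ∎
    where
    open ≡-Reasoning
    vanish : Σ≤ n (λ j → 0ℚ * f (n ∸ j)) ≡ 0ℚ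
    vanish = trans (Σ≤-cong n (λ j → ℚ.*-zeroˡ (f (n ∸ j)))) (Σ≤-zero n)

  ⋆-identityˡ : ∀ f → 1ₛ ⋆ f ≈ₛ f
  ⋆-identityˡ f n = trans (κ⋆f≡c*f 1ℚ f n) (ℚ.*-identityˡ (f n))

  ⋆-identityʳ : ∀ f → f ⋆ 1ₛ ≈ₛ f
  ⋆-identityʳ f n = trans (⋆-comm f 1ₛ n) (⋆-identityˡ f n)

  ≈ₛ-sym : ∀ {f g} → f ≈ₛ g → g ≈ₛ f
  ≈ₛ-sym f≈g n = sym (f≈g n)

  ≈ₛ-trans : ∀ {f g h} → f ≈ₛ g → g ≈ₛ h → f ≈ₛ h
  ≈ₛ-trans f≈g g≈h n = trans (f≈g n) (g≈h n)

  ≈ₛ-isEquivalence : IsEquivalence _≈ₛ_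
  ≈ₛ-isEquivalence = record { refl = λ n → refl ; sym = ≈ₛ-sym ; trans = ≈ₛ-trans }

  ⋆-⊕-isCommutativeRing : IsCommutativeRing _≈ₛ_ _⊕_ _⋆_ ⊝_ 0ₛ 1ₛ
  ⋆-⊕-isCommutativeRing = record
    { isRing = record
      { +-isAbelianGroup = record
        { isGroup = record
          { isMonoid = record
            { isSemigroup = record
              { isMagma = record
                { isEquivalence = ≈ₛ-isEquivalence
                ; ∙-cong = ⊕-cong }
              ; assoc = λ f g h n → ℚ.+-assoc (f n) (g n) (h n) }
            ; identity = (λ f n → ℚ.+-identityˡ (f n)) , (λ f n → ℚ.+-identityʳ (f n)) }
          ; inverse = (λ f n → ℚ.+-inverseˡ (f n)) , (λ f n → ℚ.+-inverseʳ (f n))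
          ; ⁻¹-cong = ⊝-cong }
        ; comm = λ f g n → ℚ.+-comm (f n) (g n) }
      ; *-cong = ⋆-cong
      ; *-assoc = ⋆-assoc
      ; *-identity = ⋆-identityˡ , ⋆-identityʳ
      ; distrib = ⋆-distribˡ-⊕ , ⋆-distribʳ-⊕ }
    ; *-comm = ⋆-comm }

  ⋆-⊕-commutativeRing : CommutativeRing 0ℓ 0ℓ
  ⋆-⊕-commutativeRing = record { isCommutativeRing = ⋆-⊕-isCommutativeRing }

  open CommutativeRing ⋆-⊕-commutativeRing public using () renaming (setoid to ≈ₛ-setoid)

  module ≈ₛ-Reasoning = SetoidReasoning ≈ₛ-setoid

  κ-+ : ∀ a b → κ (a + b) ≈ₛ κ a ⊕ κ b
  κ-+ a b zero    = refl
  κ-+ a b (suc n) = sym (ℚ.+-identityʳ 0ℚ)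

  module SeriesSolver where

    κ-morphism : ACR._-Raw-AlmostCommutative⟶_ ℚ.+-*-rawRing (ACR.fromCommutativeRing ⋆-⊕-commutativeRing)
    κ-morphism = record
      { ⟦_⟧    = κ
      ; +-homo = κ-+
      ; *-homo = λ a b n → trans (κ-* a b n) (sym (κ⋆f≡c*f a (κ b) n))
      ; -‿homo = λ { a zero → refl ; a (suc n) → refl }
      ; 0-homo = λ { zero → refl ; (suc n) → refl }
      ; 1-homo = λ { zero → refl ; (suc n) → refl } }
      where
      κ-* : ∀ a b n → κ (a * b) n ≡ a * κ b n
      κ-* a b zero    = refl
      κ-* a b (suc n) = sym (ℚ.*-zeroʳ a)

    κ-equal? : ∀ a b → Maybe (κ a ≈ₛ κ b)
    κ-equal? a b with a ℚ.≟ b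
    ... | yes refl = just (λ _ → refl)
    ... | no _     = nothing

    open import Algebra.Solver.Ring ℚ.+-*-rawRing (ACR.fromCommutativeRing ⋆-⊕-commutativeRing) κ-morphism κ-equal? public

  X : Ser
  X = xCoeff

  X⋆f-suc : ∀ f n → (X ⋆ f) (suc n) ≡ f n
  X⋆f-suc f zero    = trans (cong₂ _+_ (ℚ.*-zeroˡ (f 1)) (ℚ.*-identityˡ (f 0))) (ℚ.+-identityˡ (f 0))
  X⋆f-suc f (suc n) = begin
    Σ≤ (suc (suc n)) (λ j → X j * f (suc (suc n) ∸ j))
      ≡⟨ Σ≤-head (suc n) _ ⟩
    0ℚ * f (suc (suc n)) + Σ≤ (suc n) (λ j → X (suc j) * f (suc n ∸ j))
      ≡⟨ cong (0ℚ * f (suc (suc n)) +_) (Σ≤-head n _) ⟩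
    0ℚ * f (suc (suc n)) + (1ℚ * f (suc n) + Σ≤ n (λ j → 0ℚ * f (n ∸ j)))
      ≡⟨ cong₂ (λ x y → x + (y + Σ≤ n (λ j → 0ℚ * f (n ∸ j)))) (ℚ.*-zeroˡ (f (suc (suc n)))) (ℚ.*-identityˡ (f (suc n))) ⟩
    0ℚ + (f (suc n) + Σ≤ n (λ j → 0ℚ * f (n ∸ j)))
      ≡⟨ cong (λ x → 0ℚ + (f (suc n) + x)) (trans (Σ≤-cong n (λ j → ℚ.*-zeroˡ (f (n ∸ j)))) (Σ≤-zero n)) ⟩
    0ℚ + (f (suc n) + 0ℚ)
      ≡⟨ trans (ℚ.+-identityˡ _) (ℚ.+-identityʳ _) ⟩
    f (suc n)
      ∎
    where open ≡-Reasoning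

  X⋆-cancel : ∀ f → X ⋆ f ≈ₛ 0ₛ → f ≈ₛ 0ₛ
  X⋆-cancel f X⋆f≈0 n = trans (sym (X⋆f-suc f n)) (X⋆f≈0 (suc n))

  shift : Ser → Ser
  shift f n = f (suc n)

  X⋆shift : ∀ f → f 0 ≡ 0ℚ → f ≈ₛ X ⋆ shift f
  X⋆shift f f0≡0 zero    = trans f0≡0 (sym (ℚ.*-zeroˡ (f 1)))
  X⋆shift f f0≡0 (suc n) = sym (X⋆f-suc (shift f) n)

  ⋆-cancel-unit : ∀ f g c → c * f 0 ≡ 1ℚ → f ⋆ g ≈ₛ 0ₛ → g ≈ₛ 0ₛ
  ⋆-cancel-unit f g c c*f0≡1 f⋆g≈0 n = vanish n n ℕ.≤-refl
    where
    open ≡-Reasoning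
    from-leading : ∀ n → f 0 * g n ≡ 0ℚ → g n ≡ 0ℚ
    from-leading n f0*gn≡0 = begin
      g n              ≡⟨ ℚ.*-identityˡ (g n) ⟨
      1ℚ * g n         ≡⟨ cong (_* g n) c*f0≡1 ⟨
      c * f 0 * g n    ≡⟨ ℚ.*-assoc c (f 0) (g n) ⟩
      c * (f 0 * g n)  ≡⟨ cong (c *_) f0*gn≡0 ⟩
      c * 0ℚ           ≡⟨ ℚ.*-zeroʳ c ⟩
      0ℚ               ∎
    vanish : ∀ n m → m ℕ.≤ n → g m ≡ 0ℚ
    vanish zero    zero _ = from-leading 0 (f⋆g≈0 0)
    vanish (suc n) m m≤1+n with ℕ.m≤n⇒m<n∨m≡n m≤1+n
    ... | inj₁ (ℕ.s≤s m≤n) = vanish n m m≤n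
    ... | inj₂ refl        = from-leading (suc n) (begin
      f 0 * g (suc n)                                        ≡⟨ ℚ.+-identityʳ _ ⟨
      f 0 * g (suc n) + 0ℚ                                   ≡⟨ cong (f 0 * g (suc n) +_) lower ⟨
      f 0 * g (suc n) + Σ≤ n (λ j → f (suc j) * g (n ∸ j))   ≡⟨ Σ≤-head n (λ j → f j * g (suc n ∸ j)) ⟨
      (f ⋆ g) (suc n)                                        ≡⟨ f⋆g≈0 (suc n) ⟩
      0ℚ                                                     ∎)
      where
      lower : Σ≤ n (λ j → f (suc j) * g (n ∸ j)) ≡ 0ℚ
      lower = trans (Σ≤-cong n (λ j → trans (cong (f (suc j) *_) (vanish n (n ∸ j) (ℕ.m∸n≤m n j)))
                                            (ℚ.*-zeroʳ (f (suc j)))))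
                    (Σ≤-zero n)

  dilate : ℚ → Ser → Ser
  dilate c f n = c ^ℚ n * f n

  dilate-cong : ∀ c {f g} → f ≈ₛ g → dilate c f ≈ₛ dilate c g
  dilate-cong c f≈g n = cong (c ^ℚ n *_) (f≈g n)

  dilate-⊕ : ∀ c f g → dilate c (f ⊕ g) ≈ₛ dilate c f ⊕ dilate c g
  dilate-⊕ c f g n = ℚ.*-distribˡ-+ (c ^ℚ n) (f n) (g n)

  dilate-⊝ : ∀ c f → dilate c (⊝ f) ≈ₛ ⊝ dilate c f
  dilate-⊝ c f n = sym (ℚ.neg-distribʳ-* (c ^ℚ n) (f n))

  dilate-⋆ : ∀ c f g → dilate c (f ⋆ g) ≈ₛ dilate c f ⋆ dilate c g
  dilate-⋆ c f g n = trans (sym (Σ≤-*ˡ n (c ^ℚ n) _)) (Σ≤-cong-≤ n λ j j≤n → begin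
    c ^ℚ n * (f j * g (n ∸ j))                          ≡⟨ cong (λ m → c ^ℚ m * (f j * g (n ∸ j))) (ℕ.m+[n∸m]≡n j≤n) ⟨
    c ^ℚ (j ℕ.+ (n ∸ j)) * (f j * g (n ∸ j))            ≡⟨ cong (_* (f j * g (n ∸ j))) (^ℚ-+ c j (n ∸ j)) ⟩
    c ^ℚ j * c ^ℚ (n ∸ j) * (f j * g (n ∸ j))           ≡⟨ interchange (c ^ℚ j) (c ^ℚ (n ∸ j)) (f j) (g (n ∸ j)) ⟩
    c ^ℚ j * f j * (c ^ℚ (n ∸ j) * g (n ∸ j))           ∎)
    where
    open ≡-Reasoning
    interchange : ∀ a b x y → a * b * (x * y) ≡ a * x * (b * y)
    interchange = solve-∀ ℚ-ring

  dilate-κ : ∀ c a → dilate c (κ a) ≈ₛ κ a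
  dilate-κ c a zero    = ℚ.*-identityˡ a
  dilate-κ c a (suc n) = ℚ.*-zeroʳ (c ^ℚ suc n)

  dilate-X : ∀ c → dilate c X ≈ₛ κ c ⋆ X
  dilate-X c n = trans (at-X n) (sym (κ⋆f≡c*f c X n))
    where
    at-X : ∀ n → dilate c X n ≡ c * X n
    at-X zero          = trans (ℚ.*-zeroʳ 1ℚ) (sym (ℚ.*-zeroʳ c))
    at-X (suc zero)    = cong (_* 1ℚ) (ℚ.*-identityʳ c)
    at-X (suc (suc n)) = trans (ℚ.*-zeroʳ (c ^ℚ suc (suc n))) (sym (ℚ.*-zeroʳ c))

module Exponential where

  open import Data.Bool using (true; false)
  open import Data.Nat as ℕ using (ℕ; zero; suc; _∸_)
  import Data.Nat.Properties as ℕ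
  open import Data.Rational using (ℚ; 0ℚ; 1ℚ; ½; _+_; _*_; -_)
  import Data.Rational.Properties as ℚ
  open import Relation.Binary.PropositionalEquality
  open RationalRingSolver using (solve-∀; ℚ-ring)
  open FiniteSums
  open Rationals
  open Parity
  open PowerSeries

  D : Ser → Ser
  D f n = fromℕ (suc n) * f (suc n)

  D-⋆ : ∀ f g → D (f ⋆ g) ≈ₛ D f ⋆ g ⊕ f ⋆ D g
  D-⋆ f g n = begin
    fromℕ (suc n) * Σ≤ (suc n) t              ≡⟨ Σ≤-*ˡ (suc n) (fromℕ (suc n)) t ⟨
    Σ≤ (suc n) (λ j → fromℕ (suc n) * t j)    ≡⟨ Σ≤-cong-≤ (suc n) split ⟩
    Σ≤ (suc n) (λ j → left j + right j)       ≡⟨ Σ≤-+ (suc n) left right ⟩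
    Σ≤ (suc n) left + Σ≤ (suc n) right        ≡⟨ cong₂ _+_ left-sum right-sum ⟩
    (D f ⋆ g) n + (f ⋆ D g) n                 ∎
    where
    open ≡-Reasoning
    t left right : ℕ → ℚ
    t j     = f j * g (suc n ∸ j)
    left j  = fromℕ j * t j
    right j = fromℕ (suc n ∸ j) * t j
    split : ∀ j → j ℕ.≤ suc n → fromℕ (suc n) * t j ≡ left j + right j
    split j j≤1+n = begin
      fromℕ (suc n) * t j                       ≡⟨ cong (λ m → fromℕ m * t j) (ℕ.m+[n∸m]≡n j≤1+n) ⟨
      fromℕ (j ℕ.+ (suc n ∸ j)) * t j           ≡⟨ cong (_* t j) (fromℕ-+ j (suc n ∸ j)) ⟩
      (fromℕ j + fromℕ (suc n ∸ j)) * t j       ≡⟨ ℚ.*-distribʳ-+ (t j) (fromℕ j) (fromℕ (suc n ∸ j)) ⟩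
      left j + right j                          ∎
    left-sum : Σ≤ (suc n) left ≡ (D f ⋆ g) n
    left-sum = begin
      Σ≤ (suc n) left                                 ≡⟨ Σ≤-head n left ⟩
      0ℚ * t 0 + Σ≤ n (λ j → left (suc j))            ≡⟨ cong₂ _+_ (ℚ.*-zeroˡ (t 0)) (Σ≤-cong n reassoc) ⟩
      0ℚ + (D f ⋆ g) n                                ≡⟨ ℚ.+-identityˡ _ ⟩
      (D f ⋆ g) n                                     ∎
      where
      reassoc : ∀ j → left (suc j) ≡ D f j * g (n ∸ j)
      reassoc j = sym (ℚ.*-assoc (fromℕ (suc j)) (f (suc j)) (g (n ∸ j)))
    right-sum : Σ≤ (suc n) right ≡ (f ⋆ D g) n
    right-sum = begin
      Σ≤ n right + right (suc n)      ≡⟨ cong (Σ≤ n right +_) last ⟩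
      Σ≤ n right + 0ℚ                 ≡⟨ ℚ.+-identityʳ _ ⟩
      Σ≤ n right                      ≡⟨ Σ≤-cong-≤ n move ⟩
      (f ⋆ D g) n                     ∎
      where
      last : right (suc n) ≡ 0ℚ
      last rewrite ℕ.n∸n≡0 n = ℚ.*-zeroˡ (f (suc n) * g 0)
      exchange : ∀ a b c → a * (b * c) ≡ b * (a * c)
      exchange = solve-∀ ℚ-ring
      move : ∀ j → j ℕ.≤ n → right j ≡ f j * D g (n ∸ j)
      move j j≤n rewrite ℕ.+-∸-assoc 1 j≤n = exchange (fromℕ (suc (n ∸ j))) (f j) (g (suc (n ∸ j)))

  exp : ℚ → Ser
  exp c n = c ^ℚ n * inv! n

  D-exp : ∀ c → D (exp c) ≈ₛ κ c ⋆ exp c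
  D-exp c n = begin
    fromℕ (suc n) * (c * c ^ℚ n * inv! (suc n))       ≡⟨ regroup (fromℕ (suc n)) c (c ^ℚ n) (inv! (suc n)) ⟩
    c * c ^ℚ n * (inv! (suc n) * fromℕ (suc n))       ≡⟨ cong (c * c ^ℚ n *_) (inv!-suc n) ⟩
    c * c ^ℚ n * inv! n                               ≡⟨ ℚ.*-assoc c _ _ ⟩
    c * exp c n                                       ≡⟨ κ⋆f≡c*f c (exp c) n ⟨
    (κ c ⋆ exp c) n                                   ∎
    where
    open ≡-Reasoning
    regroup : ∀ a c p i → a * (c * p * i) ≡ c * p * (i * a)
    regroup = solve-∀ ℚ-ring

  D-unique : ∀ c f g → D f ≈ₛ κ c ⋆ f → D g ≈ₛ κ c ⋆ g → f 0 ≡ g 0 → f ≈ₛ g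
  D-unique c f g Df Dg f0≡g0 zero    = f0≡g0
  D-unique c f g Df Dg f0≡g0 (suc n) = *-cancelˡ-fromℕ-suc n (begin
    D f n              ≡⟨ trans (Df n) (κ⋆f≡c*f c f n) ⟩
    c * f n            ≡⟨ cong (c *_) (D-unique c f g Df Dg f0≡g0 n) ⟩
    c * g n            ≡⟨ trans (Dg n) (κ⋆f≡c*f c g n) ⟨
    D g n              ∎)
    where open ≡-Reasoning

  exp-+ : ∀ c d → exp c ⋆ exp d ≈ₛ exp (c + d)
  exp-+ c d = D-unique (c + d) (exp c ⋆ exp d) (exp (c + d)) D[exp⋆exp] (D-exp (c + d)) refl
    where
    open ≈ₛ-Reasoning
    open SeriesSolver
    D[exp⋆exp] : D (exp c ⋆ exp d) ≈ₛ κ (c + d) ⋆ (exp c ⋆ exp d)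
    D[exp⋆exp] = begin
      D (exp c ⋆ exp d)                              ≈⟨ D-⋆ (exp c) (exp d) ⟩
      D (exp c) ⋆ exp d ⊕ exp c ⋆ D (exp d)          ≈⟨ ⊕-cong (⋆-congʳ (exp d) (D-exp c)) (⋆-congˡ (exp c) (D-exp d)) ⟩
      (κ c ⋆ exp c) ⋆ exp d ⊕ exp c ⋆ (κ d ⋆ exp d)  ≈⟨ solve 4 (λ C D u v → (C :* u) :* v :+ u :* (D :* v)
                                                                      := (C :+ D) :* (u :* v))
                                                           (λ _ → refl) (κ c) (κ d) (exp c) (exp d) ⟩
      (κ c ⊕ κ d) ⋆ (exp c ⋆ exp d)                  ≈⟨ ⋆-congʳ (exp c ⋆ exp d) (κ-+ c d) ⟨
      κ (c + d) ⋆ (exp c ⋆ exp d)                    ∎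

  exp-0 : exp 0ℚ ≈ₛ 1ₛ
  exp-0 zero    = refl
  exp-0 (suc n) = trans (cong (_* inv! (suc n)) (ℚ.*-zeroˡ (0ℚ ^ℚ n))) (ℚ.*-zeroˡ (inv! (suc n)))

  exp⋆exp-neg : ∀ c → exp c ⋆ exp (- c) ≈ₛ 1ₛ
  exp⋆exp-neg c n = trans (exp-+ c (- c) n) (trans (cong (λ x → exp x n) (ℚ.+-inverseʳ c)) (exp-0 n))

  dilate-exp : ∀ c d → dilate c (exp d) ≈ₛ exp (c * d)
  dilate-exp c d n = trans (sym (ℚ.*-assoc (c ^ℚ n) (d ^ℚ n) (inv! n))) (cong (_* inv! n) (sym (^ℚ-distrib-* c d n)))

  cosh sinh : ℚ → Ser
  cosh c k with evenN k
  ... | true  = exp c k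
  ... | false = 0ℚ
  sinh c k with evenN k
  ... | true  = 0ℚ
  ... | false = exp c k

  exp-neg-even : ∀ c i → exp (- c) (dbl i) ≡ exp c (dbl i)
  exp-neg-even c i = cong (_* inv! (dbl i)) (begin
    (- c) ^ℚ dbl i           ≡⟨ -x^ℚn≡sign*x^ℚn c (dbl i) ⟩
    sign (dbl i) * c ^ℚ dbl i ≡⟨ cong (_* c ^ℚ dbl i) (sign-dbl i) ⟩
    1ℚ * c ^ℚ dbl i           ≡⟨ ℚ.*-identityˡ _ ⟩
    c ^ℚ dbl i                ∎)
    where open ≡-Reasoning

  exp-neg-odd : ∀ c i → exp (- c) (suc (dbl i)) ≡ - exp c (suc (dbl i))
  exp-neg-odd c i = begin
    (- c) ^ℚ suc (dbl i) * inv! (suc (dbl i))                  ≡⟨ cong (_* inv! (suc (dbl i))) (-x^ℚn≡sign*x^ℚn c (suc (dbl i))) ⟩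
    - sign (dbl i) * c ^ℚ suc (dbl i) * inv! (suc (dbl i))     ≡⟨ cong (λ s → - s * c ^ℚ suc (dbl i) * inv! (suc (dbl i))) (sign-dbl i) ⟩
    - 1ℚ * c ^ℚ suc (dbl i) * inv! (suc (dbl i))               ≡⟨ negate (c ^ℚ suc (dbl i)) (inv! (suc (dbl i))) ⟩
    - (c ^ℚ suc (dbl i) * inv! (suc (dbl i)))                  ∎
    where
    open ≡-Reasoning
    negate : ∀ x y → - 1ℚ * x * y ≡ - (x * y)
    negate = solve-∀ ℚ-ring

  cosh-even : ∀ c i → cosh c (dbl i) ≡ exp c (dbl i)
  cosh-even c i rewrite evenN-dbl i = refl

  cosh-odd : ∀ c i → cosh c (suc (dbl i)) ≡ 0ℚ
  cosh-odd c i rewrite evenN-suc-dbl i = refl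

  sinh-even : ∀ c i → sinh c (dbl i) ≡ 0ℚ
  sinh-even c i rewrite evenN-dbl i = refl

  sinh-odd : ∀ c i → sinh c (suc (dbl i)) ≡ exp c (suc (dbl i))
  sinh-odd c i rewrite evenN-suc-dbl i = refl

  cosh≈exp : ∀ c → cosh c ≈ₛ κ ½ ⋆ (exp c ⊕ exp (- c))
  cosh≈exp c n = trans (by-parity n (parity n)) (sym (κ⋆f≡c*f ½ (exp c ⊕ exp (- c)) n))
    where
    by-parity : ∀ n → Parity n → cosh c n ≡ ½ * (exp c n + exp (- c) n)
    by-parity _ (even i) = begin
      cosh c (dbl i)                                ≡⟨ cosh-even c i ⟩
      exp c (dbl i)                                 ≡⟨ mean (exp c (dbl i)) ⟨
      ½ * (exp c (dbl i) + exp c (dbl i))           ≡⟨ cong (λ x → ½ * (exp c (dbl i) + x)) (exp-neg-even c i) ⟨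
      ½ * (exp c (dbl i) + exp (- c) (dbl i))       ∎
      where
      open ≡-Reasoning
      mean : ∀ x → ½ * (x + x) ≡ x
      mean = solve-∀ ℚ-ring
    by-parity _ (odd i) = begin
      cosh c (suc (dbl i))                                  ≡⟨ cosh-odd c i ⟩
      0ℚ                                                    ≡⟨ cancel (exp c (suc (dbl i))) ⟨
      ½ * (exp c (suc (dbl i)) + - exp c (suc (dbl i)))     ≡⟨ cong (λ x → ½ * (exp c (suc (dbl i)) + x)) (exp-neg-odd c i) ⟨
      ½ * (exp c (suc (dbl i)) + exp (- c) (suc (dbl i)))   ∎
      where
      open ≡-Reasoning
      cancel : ∀ x → ½ * (x + - x) ≡ 0ℚ
      cancel = solve-∀ ℚ-ring

  sinh≈exp : ∀ c → sinh c ≈ₛ κ ½ ⋆ (exp c ⊕ ⊝ exp (- c))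
  sinh≈exp c n = trans (by-parity n (parity n)) (sym (κ⋆f≡c*f ½ (exp c ⊕ ⊝ exp (- c)) n))
    where
    by-parity : ∀ n → Parity n → sinh c n ≡ ½ * (exp c n + - exp (- c) n)
    by-parity _ (even i) = begin
      sinh c (dbl i)                                    ≡⟨ sinh-even c i ⟩
      0ℚ                                                ≡⟨ cancel (exp c (dbl i)) ⟨
      ½ * (exp c (dbl i) + - exp c (dbl i))             ≡⟨ cong (λ x → ½ * (exp c (dbl i) + - x)) (exp-neg-even c i) ⟨
      ½ * (exp c (dbl i) + - exp (- c) (dbl i))         ∎
      where
      open ≡-Reasoning
      cancel : ∀ x → ½ * (x + - x) ≡ 0ℚ
      cancel = solve-∀ ℚ-ring
    by-parity _ (odd i) = begin
      sinh c (suc (dbl i))                                    ≡⟨ sinh-odd c i ⟩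
      exp c (suc (dbl i))                                     ≡⟨ mean (exp c (suc (dbl i))) ⟨
      ½ * (exp c (suc (dbl i)) + - - exp c (suc (dbl i)))     ≡⟨ cong (λ x → ½ * (exp c (suc (dbl i)) + - x)) (exp-neg-odd c i) ⟨
      ½ * (exp c (suc (dbl i)) + - exp (- c) (suc (dbl i)))   ∎
      where
      open ≡-Reasoning
      mean : ∀ x → ½ * (x + - - x) ≡ x
      mean = solve-∀ ℚ-ring

module Twist where

  open import Data.Nat as ℕ using (ℕ; suc; _∸_)
  import Data.Nat.Properties as ℕ
  open import Data.Rational using (1ℚ; _*_)
  import Data.Rational.Properties as ℚ
  open import Relation.Binary.PropositionalEquality
  open RationalRingSolver using (solve-∀; ℚ-ring)
  open FiniteSums
  open Rationals
  open Parity
  open PowerSeries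
  open Exponential

  -- Coefficientwise the substitution x ↦ ix, with the odd part divided by i, which keeps the
  -- coefficients rational: it maps cosh to cos and sinh to sin.
  twist : Ser → Ser
  twist f n = sign (half n) * f n

  twist-involutive : ∀ f → twist (twist f) ≈ₛ f
  twist-involutive f n = begin
    sign (half n) * (sign (half n) * f n)   ≡⟨ ℚ.*-assoc (sign (half n)) _ _ ⟨
    sign (half n) * sign (half n) * f n     ≡⟨ cong (_* f n) (sign*sign≡1 (half n)) ⟩
    1ℚ * f n                                ≡⟨ ℚ.*-identityˡ (f n) ⟩
    f n                                     ∎
    where open ≡-Reasoning

  twist-injective : ∀ {f g} → twist f ≈ₛ twist g → f ≈ₛ g
  twist-injective {f} {g} tf≈tg n = begin
    f n                     ≡⟨ twist-involutive f n ⟨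
    twist (twist f) n       ≡⟨ cong (sign (half n) *_) (tf≈tg n) ⟩
    twist (twist g) n       ≡⟨ twist-involutive g n ⟩
    g n                     ∎
    where open ≡-Reasoning

  exp-1 : ∀ n → exp 1ℚ n ≡ inv! n
  exp-1 n = trans (cong (_* inv! n) (1^ℚn≡1 n)) (ℚ.*-identityˡ (inv! n))

  cos≡twist-cosh : ∀ n → cosCoeff n ≡ twist (cosh 1ℚ) n
  cos≡twist-cosh n with parity n
  ... | even i rewrite evenN-dbl i = cong (sign (half (dbl i)) *_) (sym (exp-1 (dbl i)))
  ... | odd i  rewrite evenN-suc-dbl i = sym (ℚ.*-zeroʳ (sign (half (suc (dbl i)))))

  sin≈twist-sinh : sinCoeff ≈ₛ twist (sinh 1ℚ)
  sin≈twist-sinh n with parity n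
  ... | even i rewrite evenN-dbl i = sym (ℚ.*-zeroʳ (sign (half (dbl i))))
  ... | odd i  rewrite evenN-suc-dbl i = cong (sign (half (suc (dbl i))) *_) (sym (exp-1 (suc (dbl i))))

  -- Since cosh is even, the twist is multiplicative against it: sign ⌊n/2⌋ = sign j · sign ⌊(n-j)/2⌋ for even j.
  cos⋆twist : ∀ f → cosCoeff ⋆ twist f ≈ₛ twist (cosh 1ℚ ⋆ f)
  cos⋆twist f n = trans (Σ≤-cong-≤ n (λ j j≤n → term j (parity j) j≤n (f (n ∸ j)))) (Σ≤-*ˡ n (sign (half n)) _)
    where
    open ≡-Reasoning
    term : ∀ j → Parity j → j ℕ.≤ n → ∀ x → cosCoeff j * (sign (half (n ∸ j)) * x) ≡ sign (half n) * (cosh 1ℚ j * x)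
    term _ (even i) i≤n x = begin
      cosCoeff (dbl i) * (sign (half (n ∸ dbl i)) * x)          ≡⟨ cong (_* (sign (half (n ∸ dbl i)) * x)) (cos≡twist-cosh (dbl i)) ⟩
      sign (half (dbl i)) * c * (sign (half (n ∸ dbl i)) * x)   ≡⟨ regroup (sign (half (dbl i))) c (sign (half (n ∸ dbl i))) x ⟩
      sign (half (dbl i)) * sign (half (n ∸ dbl i)) * (c * x)   ≡⟨ cong (_* (c * x)) (sign-+ (half (dbl i)) (half (n ∸ dbl i))) ⟨
      sign (half (dbl i) ℕ.+ half (n ∸ dbl i)) * (c * x)        ≡⟨ cong (λ m → sign m * (c * x)) half-split ⟩
      sign (half n) * (c * x)                                   ∎
      where
      c = cosh 1ℚ (dbl i)
      regroup : ∀ s c t x → s * c * (t * x) ≡ s * t * (c * x)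
      regroup = solve-∀ ℚ-ring
      half-split : half (dbl i) ℕ.+ half (n ∸ dbl i) ≡ half n
      half-split = begin
        half (dbl i) ℕ.+ half (n ∸ dbl i)   ≡⟨ cong (ℕ._+ half (n ∸ dbl i)) (half-dbl i) ⟩
        i ℕ.+ half (n ∸ dbl i)              ≡⟨ half-dbl-+ i (n ∸ dbl i) ⟨
        half (dbl i ℕ.+ (n ∸ dbl i))        ≡⟨ cong half (ℕ.m+[n∸m]≡n i≤n) ⟩
        half n                              ∎
    term _ (odd i) _ x rewrite evenN-suc-dbl i =
      trans (ℚ.*-zeroˡ (sign (half (n ∸ suc (dbl i))) * x)) (sym (trans (cong (sign (half n) *_) (ℚ.*-zeroˡ x)) (ℚ.*-zeroʳ (sign (half n)))))

module TangentNumbers (a : ℕ → ℚ) (a-tan : IsTanSeries a) where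

  open import Data.Nat as ℕ using (ℕ; suc; _∸_; _!)
  import Data.Nat.Properties as ℕ
  open import Data.Nat.Combinatorics using (_C_)
  open import Data.Rational using (ℚ; 0ℚ; 1ℚ; ½; _+_; _*_; -_)
  import Data.Rational.Properties as ℚ
  open import Relation.Binary.PropositionalEquality
  open RationalRingSolver using (solve-∀; ℚ-ring)
  open FiniteSums
  open Rationals
  open Parity
  open PowerSeries
  open Exponential
  open Twist

  tanh : Ser
  tanh = twist a

  cosh⋆tanh≈sinh : cosh 1ℚ ⋆ tanh ≈ₛ sinh 1ℚ
  cosh⋆tanh≈sinh = twist-injective (begin
    twist (cosh 1ℚ ⋆ tanh)   ≈⟨ cos⋆twist tanh ⟨
    cosCoeff ⋆ twist tanh    ≈⟨ ⋆-congˡ cosCoeff (twist-involutive a) ⟩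
    cosCoeff ⋆ a             ≈⟨ a-tan ⟩
    sinCoeff                 ≈⟨ sin≈twist-sinh ⟩
    twist (sinh 1ℚ)          ∎)
    where open ≈ₛ-Reasoning

  -- sinh 2x · tanh x = 2 sinh x cosh x · tanh x = 2 sinh² x
  sinh2⋆tanh≈cosh2-1 : sinh (fromℕ 2) ⋆ tanh ≈ₛ cosh (fromℕ 2) ⊕ ⊝ 1ₛ
  sinh2⋆tanh≈cosh2-1 = begin
    sinh (fromℕ 2) ⋆ tanh
      ≈⟨ ⋆-congʳ tanh (sinh≈exp (fromℕ 2)) ⟩
    κ ½ ⋆ (exp (fromℕ 2) ⊕ ⊝ exp (- fromℕ 2)) ⋆ tanh
      ≈⟨ ⋆-congʳ tanh (⋆-congˡ (κ ½) (⊕-cong (exp-+ 1ℚ 1ℚ) (⊝-cong (exp-+ (- 1ℚ) (- 1ℚ))))) ⟨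
    κ ½ ⋆ (e ⋆ e ⊕ ⊝ (m ⋆ m)) ⋆ tanh
      ≈⟨ solve 3 (λ e m t → con ½ :* (e :* e :+ :- (m :* m)) :* t := (e :+ :- m) :* (con ½ :* (e :+ m) :* t))
                 (λ _ → refl) e m tanh ⟩
    (e ⊕ ⊝ m) ⋆ (κ ½ ⋆ (e ⊕ m) ⋆ tanh)
      ≈⟨ ⋆-congˡ (e ⊕ ⊝ m) (⋆-congʳ tanh (cosh≈exp 1ℚ)) ⟨
    (e ⊕ ⊝ m) ⋆ (cosh 1ℚ ⋆ tanh)
      ≈⟨ ⋆-congˡ (e ⊕ ⊝ m) (≈ₛ-trans cosh⋆tanh≈sinh (sinh≈exp 1ℚ)) ⟩
    (e ⊕ ⊝ m) ⋆ (κ ½ ⋆ (e ⊕ ⊝ m))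
      ≈⟨ solve 2 (λ e m → (e :+ :- m) :* (con ½ :* (e :+ :- m)) := con ½ :* (e :* e :+ m :* m) :+ :- (e :* m))
                 (λ _ → refl) e m ⟩
    κ ½ ⋆ (e ⋆ e ⊕ m ⋆ m) ⊕ ⊝ (e ⋆ m)
      ≈⟨ ⊕-cong (⋆-congˡ (κ ½) (⊕-cong (exp-+ 1ℚ 1ℚ) (exp-+ (- 1ℚ) (- 1ℚ)))) (⊝-cong (exp⋆exp-neg 1ℚ)) ⟩
    κ ½ ⋆ (exp (fromℕ 2) ⊕ exp (- fromℕ 2)) ⊕ ⊝ 1ₛ
      ≈⟨ ⊕-cong (cosh≈exp (fromℕ 2)) (λ _ → refl) ⟨
    cosh (fromℕ 2) ⊕ ⊝ 1ₛ
      ∎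
    where
    open ≈ₛ-Reasoning
    open SeriesSolver
    e m : Ser
    e = exp 1ℚ
    m = exp (- 1ℚ)

  tanh-convolution : ∀ k → Σ≤ k (λ j → exp (fromℕ 2) (suc (dbl j)) * tanh (suc (dbl (k ∸ j)))) ≡ exp (fromℕ 2) (dbl (suc k))
  tanh-convolution k = begin
    Σ≤ k (λ j → exp (fromℕ 2) (suc (dbl j)) * tanh (suc (dbl (k ∸ j))))
      ≡⟨ Σ≤-cong-≤ k (λ j j≤k → cong₂ _*_ (sym (sinh-odd (fromℕ 2) j)) (cong tanh (sym (suc-dbl-∸-dbl j≤k)))) ⟩
    Σ≤ k (λ j → sinh (fromℕ 2) (suc (dbl j)) * tanh (dbl (suc k) ∸ suc (dbl j)))
      ≡⟨ Σ≤-odd k (λ i → sinh (fromℕ 2) i * tanh (dbl (suc k) ∸ i)) even-terms ⟨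
    (sinh (fromℕ 2) ⋆ tanh) (dbl (suc k))
      ≡⟨ sinh2⋆tanh≈cosh2-1 (dbl (suc k)) ⟩
    cosh (fromℕ 2) (dbl (suc k)) + - 0ℚ
      ≡⟨ ℚ.+-identityʳ _ ⟩
    cosh (fromℕ 2) (dbl (suc k))
      ≡⟨ cosh-even (fromℕ 2) (suc k) ⟩
    exp (fromℕ 2) (dbl (suc k))
      ∎
    where
    open ≡-Reasoning
    even-terms : ∀ j → sinh (fromℕ 2) (dbl j) * tanh (dbl (suc k) ∸ dbl j) ≡ 0ℚ
    even-terms j = trans (cong (_* tanh (dbl (suc k) ∸ dbl j)) (sinh-even (fromℕ 2) j)) (ℚ.*-zeroˡ (tanh (dbl (suc k) ∸ dbl j)))

  T : ℕ → ℚ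
  T = tangentNumber a

  T≡±[2m+1]!*tanh : ∀ m → T m ≡ sign m * (fromℕ (suc (dbl m) !) * tanh (suc (dbl m)))
  T≡±[2m+1]!*tanh m = begin
    fromℕ (suc (2 ℕ.* m) !) * a (suc (2 ℕ.* m))            ≡⟨ cong (λ n → fromℕ (suc n !) * a (suc n)) (dbl≡2* m) ⟨
    f * a (suc (dbl m))                                      ≡⟨ cong (f *_) (twist-involutive a (suc (dbl m))) ⟨
    f * (sign (half (suc (dbl m))) * tanh (suc (dbl m)))     ≡⟨ cong (λ n → f * (sign n * tanh (suc (dbl m)))) (half-suc-dbl m) ⟩
    f * (sign m * tanh (suc (dbl m)))                        ≡⟨ exchange f (sign m) (tanh (suc (dbl m))) ⟩
    sign m * (f * tanh (suc (dbl m)))                        ∎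
    where
    open ≡-Reasoning
    f = fromℕ (suc (dbl m) !)
    exchange : ∀ a b c → a * (b * c) ≡ b * (a * c)
    exchange = solve-∀ ℚ-ring

  tanForm-even : ∀ n → tanForm a (dbl n) ≡ T n * ¼ ^ℚ n
  tanForm-even n rewrite evenN-dbl n | half-dbl n = refl

  tanForm-odd : ∀ n → tanForm a (suc (dbl n)) ≡ 0ℚ
  tanForm-odd n rewrite evenN-suc-dbl n = refl

  T0≡1 : T 0 ≡ 1ℚ
  T0≡1 = trans (sym (ℚ.+-identityʳ (T 0))) (trans (cong (T 0 +_) (sym (ℚ.*-zeroˡ (a 0)))) (a-tan 1))

  tangent-binomial : ∀ k →
    Σ≤ k (λ j → (- fromℕ 4) ^ℚ j * fromℕ (dbl (suc k) C suc (dbl j)) * T (k ∸ j)) ≡ fromℕ 2 * (- fromℕ 4) ^ℚ k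
  tangent-binomial k = begin
    Σ≤ k (λ j → (- fromℕ 4) ^ℚ j * fromℕ (dbl (suc k) C suc (dbl j)) * T (k ∸ j))
      ≡⟨ Σ≤-cong-≤ k term ⟩
    Σ≤ k (λ j → c * (exp (fromℕ 2) (suc (dbl j)) * tanh (suc (dbl (k ∸ j)))))
      ≡⟨ Σ≤-*ˡ k c _ ⟩
    c * Σ≤ k (λ j → exp (fromℕ 2) (suc (dbl j)) * tanh (suc (dbl (k ∸ j))))
      ≡⟨ cong (c *_) (tanh-convolution k) ⟩
    c * (fromℕ 2 ^ℚ N * inv! N)
      ≡⟨ regroup (sign k) (fromℕ 2 ^ℚ N) (inv! N) (fromℕ (N !)) ⟩
    sign k * ½ * fromℕ 2 ^ℚ N * (inv! N * fromℕ (N !))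
      ≡⟨ cong₂ (λ p u → sign k * ½ * p * u) (^ℚ-dbl (fromℕ 2) (suc k)) (inv!*!≡1 N) ⟩
    sign k * ½ * (fromℕ 4 * fromℕ 4 ^ℚ k) * 1ℚ
      ≡⟨ simplify (sign k) (fromℕ 4 ^ℚ k) ⟩
    fromℕ 2 * (sign k * fromℕ 4 ^ℚ k)
      ≡⟨ cong (fromℕ 2 *_) (-x^ℚn≡sign*x^ℚn (fromℕ 4) k) ⟨
    fromℕ 2 * (- fromℕ 4) ^ℚ k
      ∎
    where
    open ≡-Reasoning
    N = dbl (suc k)
    c = sign k * fromℕ (N !) * ½
    regroup : ∀ s p i f → s * f * ½ * (p * i) ≡ s * ½ * p * (i * f)
    regroup = solve-∀ ℚ-ring
    simplify : ∀ s p → s * ½ * (fromℕ 4 * p) * 1ℚ ≡ fromℕ 2 * (s * p)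
    simplify = solve-∀ ℚ-ring
    term : ∀ j → j ℕ.≤ k → (- fromℕ 4) ^ℚ j * fromℕ (N C suc (dbl j)) * T (k ∸ j)
                          ≡ c * (exp (fromℕ 2) (suc (dbl j)) * tanh (suc (dbl (k ∸ j))))
    term j j≤k = begin
      (- fromℕ 4) ^ℚ j * B * T (k ∸ j)
        ≡⟨ cong₂ (λ p t → p * B * t) (-x^ℚn≡sign*x^ℚn (fromℕ 4) j) (T≡±[2m+1]!*tanh (k ∸ j)) ⟩
      sign j * fromℕ 4 ^ℚ j * B * (sign (k ∸ j) * (fromℕ (r !) * tanh r))
        ≡⟨ regroup′ (sign j) (fromℕ 4 ^ℚ j) B (sign (k ∸ j)) (fromℕ (r !)) (tanh r) ⟩
      sign j * sign (k ∸ j) * (B * fromℕ (r !)) * (fromℕ 4 ^ℚ j * tanh r)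
        ≡⟨ cong₂ (λ x y → x * y * (fromℕ 4 ^ℚ j * tanh r)) signs binomial ⟩
      sign k * (fromℕ (N !) * inv! s) * (fromℕ 4 ^ℚ j * tanh r)
        ≡⟨ regroup″ (sign k) (fromℕ (N !)) (inv! s) (fromℕ 4 ^ℚ j) (tanh r) ⟩
      c * (fromℕ 2 * fromℕ 4 ^ℚ j * inv! s * tanh r)
        ≡⟨ cong (λ p → c * (fromℕ 2 * p * inv! s * tanh r)) (^ℚ-dbl (fromℕ 2) j) ⟨
      c * (exp (fromℕ 2) s * tanh r)
        ∎
      where
      s = suc (dbl j)
      r = suc (dbl (k ∸ j))
      B = fromℕ (N C s)
      signs : sign j * sign (k ∸ j) ≡ sign k
      signs = trans (sym (sign-+ j (k ∸ j))) (cong sign (ℕ.m+[n∸m]≡n j≤k))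
      binomial : B * fromℕ (r !) ≡ fromℕ (N !) * inv! s
      binomial = subst (λ n → fromℕ (n C s) * fromℕ (r !) ≡ fromℕ (n !) * inv! s)
                       (suc-dbl-+-suc-dbl j≤k) ([m+n]Cm*n!≡[m+n]!*inv!m s r)
      regroup′ : ∀ σ p b τ f t → σ * p * b * (τ * (f * t)) ≡ σ * τ * (b * f) * (p * t)
      regroup′ = solve-∀ ℚ-ring
      regroup″ : ∀ σ f i p t → σ * (f * i) * (p * t) ≡ σ * f * ½ * (fromℕ 2 * p * i * t)
      regroup″ = solve-∀ ℚ-ring

module Walks where

  open import Level using (0ℓ)
  open import Algebra.Bundles using (CommutativeMonoid)
  open import Data.Bool using (Bool; true; false; if_then_else_)
  import Data.Bool as Bool
  open import Data.Integer as ℤ using (+_)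
  open import Data.List using (List; []; _∷_; length; filter; concatMap; _++_)
  import Data.List.Properties as List
  open import Data.Maybe using (Maybe; just; nothing)
  open import Data.Nat as ℕ using (ℕ; zero; suc; _+_; _*_; _≤_; _≡ᵇ_)
  import Data.Nat.Properties as ℕ
  open import Data.Nat.Tactic.RingSolver using (solve-∀)
  open import Data.Product using (_×_; _,_)
  open import Relation.Binary.PropositionalEquality using (_≡_; refl; sym; trans; cong; cong₂; module ≡-Reasoning)
  open import Relation.Nullary.Decidable using (does)
  open import Relation.Unary using (Decidable)

  move : Step → ℕ → ℕ → Maybe (ℕ × ℕ)
  move NW zero    y       = nothing
  move NW (suc x) y       = just (x , suc y)
  move NE x       y       = just (suc x , suc y)
  move SE x       zero    = nothing
  move SE x       (suc y) = just (suc x , y)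

  premove : Step → ℕ → ℕ → Maybe (ℕ × ℕ)
  premove NW i       zero    = nothing
  premove NW i       (suc j) = just (suc i , j)
  premove NE zero    j       = nothing
  premove NE (suc i) zero    = nothing
  premove NE (suc i) (suc j) = just (i , j)
  premove SE zero    j       = nothing
  premove SE (suc i) j       = just (i , suc j)

  premove-sum-≤ : ∀ s {i j p q} → premove s i j ≡ just (p , q) → p + q ≤ i + j
  premove-sum-≤ NW {i}     {suc j} refl = ℕ.≤-reflexive (sym (ℕ.+-suc i j))
  premove-sum-≤ NE {suc i} {suc j} refl = ℕ.+-mono-≤ (ℕ.n≤1+n i) (ℕ.n≤1+n j)
  premove-sum-≤ SE {suc i} {j}     refl = ℕ.≤-reflexive (ℕ.+-suc i j)

  module StepSums (M : CommutativeMonoid 0ℓ 0ℓ) where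

    open CommutativeMonoid M
      using (ε; _∙_; _≈_; ∙-cong; ∙-congʳ; identityˡ; identityʳ; setoid; commutativeSemigroup)
      renaming (Carrier to A; refl to ≈-refl; sym to ≈-sym; trans to ≈-trans)

    at : Maybe (ℕ × ℕ) → (ℕ → ℕ → A) → A
    at nothing        f = ε
    at (just (x , y)) f = f x y

    Σ-steps : (Step → A) → A
    Σ-steps g = g NW ∙ g NE ∙ g SE

    forward : (ℕ → ℕ → A) → ℕ → ℕ → A
    forward f x y = Σ-steps (λ s → at (move s x y) f)

    backward : (ℕ → ℕ → A) → ℕ → ℕ → A
    backward f i j = Σ-steps (λ s → at (premove s i j) f)

    open import Relation.Binary.Reasoning.Setoid setoid
    open import Algebra.Properties.CommutativeSemigroup commutativeSemigroup using (interchange)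

    backward-∙ : ∀ f g i j → backward (λ p q → f p q ∙ g p q) i j ≈ backward f i j ∙ backward g i j
    backward-∙ f g i j = begin
      at₁ NW ∙ at₁ NE ∙ at₁ SE                                      ≈⟨ ∙-cong (∙-cong (split NW) (split NE)) (split SE) ⟩
      (at₂ f NW ∙ at₂ g NW) ∙ (at₂ f NE ∙ at₂ g NE) ∙ (at₂ f SE ∙ at₂ g SE)
        ≈⟨ ∙-congʳ (interchange (at₂ f NW) (at₂ g NW) (at₂ f NE) (at₂ g NE)) ⟩
      (at₂ f NW ∙ at₂ f NE) ∙ (at₂ g NW ∙ at₂ g NE) ∙ (at₂ f SE ∙ at₂ g SE)
        ≈⟨ interchange (at₂ f NW ∙ at₂ f NE) (at₂ g NW ∙ at₂ g NE) (at₂ f SE) (at₂ g SE) ⟩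
      backward f i j ∙ backward g i j                                ∎
      where
      at₁ : Step → A
      at₁ s = at (premove s i j) (λ p q → f p q ∙ g p q)
      at₂ : (ℕ → ℕ → A) → Step → A
      at₂ h s = at (premove s i j) h
      split : ∀ s → at₁ s ≈ at₂ f s ∙ at₂ g s
      split s with premove s i j
      ... | nothing       = ≈-sym (identityˡ ε)
      ... | just (p , q)  = ≈-refl

    backward-ε : ∀ i j → backward (λ _ _ → ε) i j ≈ ε
    backward-ε i j = ≈-trans (∙-cong (∙-cong (at-ε NW) (at-ε NE)) (at-ε SE)) (≈-trans (identityʳ (ε ∙ ε)) (identityˡ ε))
      where
      at-ε : ∀ s → at (premove s i j) (λ _ _ → ε) ≈ ε
      at-ε s with premove s i j
      ... | nothing      = ≈-refl
      ... | just (p , q) = ≈-refl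

    backward-cong : ∀ {f g} → (∀ p q → f p q ≈ g p q) → ∀ i j → backward f i j ≈ backward g i j
    backward-cong {f} {g} f≈g i j = ∙-cong (∙-cong (at-cong NW) (at-cong NE)) (at-cong SE)
      where
      at-cong : ∀ s → at (premove s i j) f ≈ at (premove s i j) g
      at-cong s with premove s i j
      ... | nothing      = ≈-refl
      ... | just (p , q) = f≈g p q

    backward-mono-on : ∀ {ℓ} (_≤ₐ_ : A → A → Set ℓ) → ε ≤ₐ ε → (∀ {a b c d} → a ≤ₐ b → c ≤ₐ d → (a ∙ c) ≤ₐ (b ∙ d)) →
                       ∀ I {f g} → (∀ p q → p + q ≤ I → f p q ≤ₐ g p q) →
                       ∀ i j → i + j ≤ I → backward f i j ≤ₐ backward g i j
    backward-mono-on _≤ₐ_ ε≤ε ∙-mono I {f} {g} f≤g i j i+j≤I = ∙-mono (∙-mono (at-mono NW) (at-mono NE)) (at-mono SE)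
      where
      at-mono : ∀ s → at (premove s i j) f ≤ₐ at (premove s i j) g
      at-mono s with premove s i j in eq
      ... | nothing      = ε≤ε
      ... | just (p , q) = f≤g p q (ℕ.≤-trans (premove-sum-≤ s eq) i+j≤I)

  module _ (M N : CommutativeMonoid 0ℓ 0ℓ) where

    private
      module M = CommutativeMonoid M
      module N = CommutativeMonoid N

    backward-homomorphic : ∀ (h : M.Carrier → N.Carrier) → h M.ε N.≈ N.ε → (∀ x y → h (x M.∙ y) N.≈ h x N.∙ h y) →
                           ∀ f i j → h (StepSums.backward M f i j) N.≈ StepSums.backward N (λ p q → h (f p q)) i j
    backward-homomorphic h h-ε h-∙ f i j =
      N.trans (h-∙ _ _) (N.∙-cong (N.trans (h-∙ _ _) (N.∙-cong (at-hom NW) (at-hom NE))) (at-hom SE))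
      where
      at-hom : ∀ s → h (StepSums.at M (premove s i j) f) N.≈ StepSums.at N (premove s i j) (λ p q → h (f p q))
      at-hom s with premove s i j
      ... | nothing      = h-ε
      ... | just (p , q) = N.refl

  open StepSums ℕ.+-0-commutativeMonoid

  δ : ℕ → ℕ → ℕ
  δ a b = if a ≡ᵇ b then 1 else 0

  count : ℕ → ℕ → ℕ → ℕ → ℕ → ℕ
  count zero    x y i j = δ x i * δ y j
  count (suc n) x y i j = forward (λ x′ y′ → count n x′ y′ i j) x y

  walksFrom : ℕ → ℤ.ℤ → ℤ.ℤ → ℕ → ℕ → ℕ
  walksFrom n X Y i j = length (filter (λ w → validFrom X Y w i j Bool.≟ true) (allWords n))

  extend : List Step → List (List Step)
  extend w = (NW ∷ w) ∷ (NE ∷ w) ∷ (SE ∷ w) ∷ []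

  indicator : Bool → ℕ
  indicator b = if b then 1 else 0

  length-filter-∷ : ∀ {P : List Step → Set} (P? : Decidable P) w ws →
                    length (filter P? (w ∷ ws)) ≡ indicator (does (P? w)) + length (filter P? ws)
  length-filter-∷ P? w ws with does (P? w)
  ... | true  = refl
  ... | false = refl

  length-filter-extend : ∀ {P : List Step → Set} (P? : Decidable P) ws →
    length (filter P? (concatMap extend ws)) ≡ Σ-steps (λ s → length (filter (λ w → P? (s ∷ w)) ws))
  length-filter-extend P? []       = refl
  length-filter-extend P? (w ∷ ws) = begin
    length (filter P? (extend w ++ concatMap extend ws))
      ≡⟨ cong length (List.filter-++ P? (extend w) (concatMap extend ws)) ⟩
    length (filter P? (extend w) ++ filter P? (concatMap extend ws))
      ≡⟨ List.length-++ (filter P? (extend w)) ⟩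
    length (filter P? (extend w)) + length (filter P? (concatMap extend ws))
      ≡⟨ cong₂ _+_ head (length-filter-extend P? ws) ⟩
    (ind NW + (ind NE + (ind SE + 0))) + (rest NW + rest NE + rest SE)
      ≡⟨ regroup (ind NW) (ind NE) (ind SE) (rest NW) (rest NE) (rest SE) ⟩
    (ind NW + rest NW) + (ind NE + rest NE) + (ind SE + rest SE)
      ≡⟨ cong₂ _+_ (cong₂ _+_ (step NW) (step NE)) (step SE) ⟨
    Σ-steps (λ s → length (filter (λ w → P? (s ∷ w)) (w ∷ ws)))
      ∎
    where
    open ≡-Reasoning
    ind rest : Step → ℕ
    ind s  = indicator (does (P? (s ∷ w)))
    rest s = length (filter (λ w → P? (s ∷ w)) ws)
    head : length (filter P? (extend w)) ≡ ind NW + (ind NE + (ind SE + 0))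
    head = trans (length-filter-∷ P? (NW ∷ w) _) (cong (λ k → ind NW + k)
             (trans (length-filter-∷ P? (NE ∷ w) _) (cong (λ k → ind NE + k) (length-filter-∷ P? (SE ∷ w) []))))
    step : ∀ s → length (filter (λ w → P? (s ∷ w)) (w ∷ ws)) ≡ ind s + rest s
    step s = length-filter-∷ (λ w → P? (s ∷ w)) w ws
    regroup : ∀ a b c x y z → (a + (b + (c + 0))) + (x + y + z) ≡ (a + x) + (b + y) + (c + z)
    regroup = solve-∀

  length-filter-false : ∀ (ws : List (List Step)) → length (filter (λ w → false Bool.≟ true) ws) ≡ 0
  length-filter-false []       = refl
  length-filter-false (w ∷ ws) = length-filter-false ws

  walksFrom-step : ∀ n s x y i j →
    length (filter (λ w → validFrom (+ x) (+ y) (s ∷ w) i j Bool.≟ true) (allWords n))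
    ≡ at (move s x y) (λ x′ y′ → walksFrom n (+ x′) (+ y′) i j)
  walksFrom-step n NW zero    y       i j = length-filter-false (allWords n)
  walksFrom-step n NW (suc x) y       i j = cong (λ b → walksFrom n (+ x) (+ b) i j) (ℕ.+-comm y 1)
  walksFrom-step n NE x       y       i j = cong₂ (λ a b → walksFrom n (+ a) (+ b) i j) (ℕ.+-comm x 1) (ℕ.+-comm y 1)
  walksFrom-step n SE x       zero    i j = length-filter-false (allWords n)
  walksFrom-step n SE x       (suc y) i j = cong (λ a → walksFrom n (+ a) (+ y) i j) (ℕ.+-comm x 1)

  at-cong : ∀ m {f g : ℕ → ℕ → ℕ} → (∀ p q → f p q ≡ g p q) → at m f ≡ at m g
  at-cong nothing        f≡g = refl
  at-cong (just (p , q)) f≡g = f≡g p q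

  walksFrom≡count : ∀ n x y i j → walksFrom n (+ x) (+ y) i j ≡ count n x y i j
  walksFrom≡count zero x y i j with x ≡ᵇ i | y ≡ᵇ j
  ... | true  | true  = refl
  ... | true  | false = refl
  ... | false | true  = refl
  ... | false | false = refl
  walksFrom≡count (suc n) x y i j =
    trans (length-filter-extend (λ w → validFrom (+ x) (+ y) w i j Bool.≟ true) (allWords n))
          (cong₂ _+_ (cong₂ _+_ (by-step NW) (by-step NE)) (by-step SE))
    where
    by-step : ∀ s → length (filter (λ w → validFrom (+ x) (+ y) (s ∷ w) i j Bool.≟ true) (allWords n))
                    ≡ at (move s x y) (λ x′ y′ → count n x′ y′ i j)
    by-step s = trans (walksFrom-step n s x y i j) (at-cong (move s x y) (λ x′ y′ → walksFrom≡count n x′ y′ i j))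

  walkCount≡count : ∀ n i j → walkCount n i j ≡ count n 0 0 i j
  walkCount≡count n = walksFrom≡count n 0 0

  first-step≡last-step : ∀ x y i j → forward (λ a b → δ a i * δ b j) x y ≡ backward (λ c d → δ x c * δ y d) i j
  first-step≡last-step x y i j = cong₂ _+_ (cong₂ _+_ (dual NW x y i j) (dual NE x y i j)) (dual SE x y i j)
    where
    dual : ∀ s x y i j → at (move s x y) (λ a b → δ a i * δ b j) ≡ at (premove s i j) (λ c d → δ x c * δ y d)
    dual NW zero    y       i       zero    = refl
    dual NW zero    y       i       (suc j) = refl
    dual NW (suc x) y       i       zero    = ℕ.*-zeroʳ (δ x i)
    dual NW (suc x) y       i       (suc j) = refl
    dual NE x       y       zero    j       = refl
    dual NE x       y       (suc i) zero    = ℕ.*-zeroʳ (δ x i)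
    dual NE x       y       (suc i) (suc j) = refl
    dual SE x       zero    zero    j       = refl
    dual SE x       zero    (suc i) j       = sym (ℕ.*-zeroʳ (δ x i))
    dual SE x       (suc y) zero    j       = refl
    dual SE x       (suc y) (suc i) j       = refl

  Σ-steps-cong : ∀ {g h : Step → ℕ} → (∀ s → g s ≡ h s) → Σ-steps g ≡ Σ-steps h
  Σ-steps-cong g≡h = cong₂ _+_ (cong₂ _+_ (g≡h NW) (g≡h NE)) (g≡h SE)

  forward-backward-comm : ∀ (K : ℕ → ℕ → ℕ → ℕ → ℕ) x y i j →
    forward (λ a b → backward (K a b) i j) x y ≡ backward (λ c d → forward (λ a b → K a b c d) x y) i j
  forward-backward-comm K x y i j = begin
    Σ-steps (λ s → at (move s x y) (λ a b → Σ-steps (λ t → at (premove t i j) (K a b))))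
      ≡⟨ Σ-steps-cong (λ s → at-Σ-steps (move s x y) (λ a b t → at (premove t i j) (K a b))) ⟩
    Σ-steps (λ s → Σ-steps (λ t → at (move s x y) (λ a b → at (premove t i j) (K a b))))
      ≡⟨ Σ-steps-cong (λ s → Σ-steps-cong (λ t → at-at (move s x y) (premove t i j))) ⟩
    Σ-steps (λ s → Σ-steps (λ t → at (premove t i j) (λ c d → at (move s x y) (λ a b → K a b c d))))
      ≡⟨ Σ-steps-swap (λ s t → at (premove t i j) (λ c d → at (move s x y) (λ a b → K a b c d))) ⟩
    Σ-steps (λ t → Σ-steps (λ s → at (premove t i j) (λ c d → at (move s x y) (λ a b → K a b c d))))
      ≡⟨ Σ-steps-cong (λ t → at-Σ-steps (premove t i j) (λ c d s → at (move s x y) (λ a b → K a b c d))) ⟨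
    Σ-steps (λ t → at (premove t i j) (λ c d → Σ-steps (λ s → at (move s x y) (λ a b → K a b c d))))
      ∎
    where
    open ≡-Reasoning
    at-Σ-steps : ∀ m (h : ℕ → ℕ → Step → ℕ) → at m (λ a b → Σ-steps (h a b)) ≡ Σ-steps (λ t → at m (λ a b → h a b t))
    at-Σ-steps nothing        h = refl
    at-Σ-steps (just (a , b)) h = refl
    at-at : ∀ m m′ → at m (λ a b → at m′ (K a b)) ≡ at m′ (λ c d → at m (λ a b → K a b c d))
    at-at nothing        nothing        = refl
    at-at nothing        (just (c , d)) = refl
    at-at (just (a , b)) nothing        = refl
    at-at (just (a , b)) (just (c , d)) = refl
    Σ-steps-swap : ∀ (h : Step → Step → ℕ) → Σ-steps (λ s → Σ-steps (h s)) ≡ Σ-steps (λ t → Σ-steps (λ s → h s t))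
    Σ-steps-swap h = swap₃ (h NW NW) (h NW NE) (h NW SE) (h NE NW) (h NE NE) (h NE SE) (h SE NW) (h SE NE) (h SE SE)
      where
      swap₃ : ∀ a b c d e f g h i → (a + b + c) + (d + e + f) + (g + h + i) ≡ (a + d + g) + (b + e + h) + (c + f + i)
      swap₃ = solve-∀

  count-last-step : ∀ n x y i j → count (suc n) x y i j ≡ backward (count n x y) i j
  count-last-step zero    x y i j = first-step≡last-step x y i j
  count-last-step (suc n) x y i j =
    trans (Σ-steps-cong (λ s → at-cong (move s x y) (λ a b → count-last-step n a b i j)))
          (forward-backward-comm (λ a b c d → count n a b c d) x y i j)

  count-parity : ∀ n x y i j → evenN (y + j + n) ≡ false → count n x y i j ≡ 0
  count-parity zero x y i j odd = trans (cong (δ x i *_) (δ-odd y j (trans (cong evenN (sym (ℕ.+-identityʳ (y + j)))) odd)))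
                                        (ℕ.*-zeroʳ (δ x i))
    where
    δ-odd : ∀ y j → evenN (y + j) ≡ false → δ y j ≡ 0
    δ-odd zero    zero    ()
    δ-odd zero    (suc j) _   = refl
    δ-odd (suc y) zero    _   = refl
    δ-odd (suc y) (suc j) odd = δ-odd y j (trans (cong (λ k → evenN (suc k)) (sym (ℕ.+-suc y j))) odd)
  count-parity (suc n) x y i j odd = Σ-steps-cong {h = λ _ → 0} (λ s → vanish s x y odd)
    where
    vanish : ∀ s x y → evenN (y + j + suc n) ≡ false → at (move s x y) (λ a b → count n a b i j) ≡ 0
    vanish NW zero    y       _   = refl
    vanish NW (suc x) y       odd = count-parity n x (suc y) i j (trans (cong evenN (sym (ℕ.+-suc (y + j) n))) odd)
    vanish NE x       y       odd = count-parity n (suc x) (suc y) i j (trans (cong evenN (sym (ℕ.+-suc (y + j) n))) odd)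
    vanish SE x       zero    _   = refl
    vanish SE x       (suc y) odd = count-parity n (suc x) y i j (trans (cong (λ k → evenN (suc k)) (sym (ℕ.+-suc (y + j) n))) odd)

module GreenFunction (a : ℕ → ℚ) (a-tan : IsTanSeries a) where

  open import Data.Bool using (true; false)
  open import Data.Nat as ℕ using (ℕ; zero; suc; _∸_)
  import Data.Nat.Properties as ℕ
  open import Data.Nat.Combinatorics using (_C_)
  open import Data.Rational as ℚ using (ℚ; 0ℚ; 1ℚ; ½; _+_; _*_; -_)
  import Data.Rational.Properties as ℚ
  open import Relation.Binary.PropositionalEquality
  open RationalRingSolver using (solve-∀; ℚ-ring)
  open FiniteSums
  open Rationals
  open Parity
  open Binomial
  open Walks using (module StepSums)
  open TangentNumbers a a-tan using (T; T0≡1; tangent-binomial; tanForm-even; tanForm-odd)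
  open StepSums ℚ.+-0-commutativeMonoid using (backward)

  U : ℕ → ℕ → ℚ
  U c k = Σ≤ k (λ j → (- fromℕ 4) ^ℚ j * fromℕ (c C suc (dbl j)) * T (k ∸ j))

  U-0 : ∀ k → U 0 k ≡ 0ℚ
  U-0 k = trans (Σ≤-cong k (λ j → trans (cong (_* T (k ∸ j)) (ℚ.*-zeroʳ ((- fromℕ 4) ^ℚ j))) (ℚ.*-zeroˡ (T (k ∸ j))))) (Σ≤-zero k)

  U-1 : ∀ k → U 1 k ≡ T k
  U-1 zero    = ℚ.*-identityˡ (T 0)
  U-1 (suc k) = begin
    Σ≤ (suc k) (λ j → (- fromℕ 4) ^ℚ j * fromℕ (1 C suc (dbl j)) * T (suc k ∸ j))
      ≡⟨ Σ≤-head k _ ⟩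
    1ℚ * 1ℚ * T (suc k) + Σ≤ k (λ j → (- fromℕ 4) ^ℚ suc j * 0ℚ * T (k ∸ j))
      ≡⟨ cong₂ _+_ (ℚ.*-identityˡ (T (suc k))) (trans (Σ≤-cong k vanish) (Σ≤-zero k)) ⟩
    T (suc k) + 0ℚ
      ≡⟨ ℚ.+-identityʳ _ ⟩
    T (suc k)
      ∎
    where
    open ≡-Reasoning
    vanish : ∀ j → (- fromℕ 4) ^ℚ suc j * 0ℚ * T (k ∸ j) ≡ 0ℚ
    vanish j = trans (cong (_* T (k ∸ j)) (ℚ.*-zeroʳ ((- fromℕ 4) ^ℚ suc j))) (ℚ.*-zeroˡ (T (k ∸ j)))

  -- c C (2j - 1), with the value 0 for j = 0
  C-previous-odd : ℕ → ℕ → ℕ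
  C-previous-odd c zero    = 0
  C-previous-odd c (suc j) = c C suc (dbl j)

  C-second-difference-odd : ∀ c j →
    fromℕ (suc (suc c) C suc (dbl j)) + fromℕ (c C suc (dbl j)) ≡ fromℕ 2 * fromℕ (suc c C suc (dbl j)) + fromℕ (C-previous-odd c j)
  C-second-difference-odd c j = begin
    fromℕ (suc (suc c) C suc (dbl j)) + fromℕ (c C suc (dbl j))         ≡⟨ fromℕ-+ (suc (suc c) C suc (dbl j)) (c C suc (dbl j)) ⟨
    fromℕ (suc (suc c) C suc (dbl j) ℕ.+ c C suc (dbl j))               ≡⟨ cong fromℕ (in-ℕ j) ⟩
    fromℕ (2 ℕ.* (suc c C suc (dbl j)) ℕ.+ C-previous-odd c j)          ≡⟨ fromℕ-+ (2 ℕ.* (suc c C suc (dbl j))) (C-previous-odd c j) ⟩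
    fromℕ (2 ℕ.* (suc c C suc (dbl j))) + fromℕ (C-previous-odd c j)
      ≡⟨ cong (_+ fromℕ (C-previous-odd c j)) (fromℕ-* 2 (suc c C suc (dbl j))) ⟩
    fromℕ 2 * fromℕ (suc c C suc (dbl j)) + fromℕ (C-previous-odd c j)  ∎
    where
    open ≡-Reasoning
    in-ℕ : ∀ j → suc (suc c) C suc (dbl j) ℕ.+ c C suc (dbl j) ≡ 2 ℕ.* (suc c C suc (dbl j)) ℕ.+ C-previous-odd c j
    in-ℕ zero    = trans (C-second-difference-1 c) (sym (ℕ.+-identityʳ _))
    in-ℕ (suc j) = C-second-difference c (suc (dbl j))

  U-second-difference : ∀ c k → U (suc (suc c)) (suc k) + U c (suc k) ≡ fromℕ 2 * U (suc c) (suc k) + (- fromℕ 4) * U c k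
  U-second-difference c k = begin
    U (suc (suc c)) (suc k) + U c (suc k)
      ≡⟨ Σ≤-+ (suc k) (term (suc (suc c))) (term c) ⟨
    Σ≤ (suc k) (λ j → term (suc (suc c)) j + term c j)
      ≡⟨ Σ≤-cong (suc k) split ⟩
    Σ≤ (suc k) (λ j → fromℕ 2 * term (suc c) j + carry j)
      ≡⟨ Σ≤-+ (suc k) (λ j → fromℕ 2 * term (suc c) j) carry ⟩
    Σ≤ (suc k) (λ j → fromℕ 2 * term (suc c) j) + Σ≤ (suc k) carry
      ≡⟨ cong₂ _+_ (Σ≤-*ˡ (suc k) (fromℕ 2) (term (suc c))) carries ⟩
    fromℕ 2 * U (suc c) (suc k) + (- fromℕ 4) * U c k
      ∎
    where
    open ≡-Reasoning
    term : ℕ → ℕ → ℚ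
    term c′ j = (- fromℕ 4) ^ℚ j * fromℕ (c′ C suc (dbl j)) * T (suc k ∸ j)
    carry : ℕ → ℚ
    carry j = (- fromℕ 4) ^ℚ j * fromℕ (C-previous-odd c j) * T (suc k ∸ j)
    split : ∀ j → term (suc (suc c)) j + term c j ≡ fromℕ 2 * term (suc c) j + carry j
    split j = begin
      p * x * t + p * y * t               ≡⟨ factor p x y t ⟩
      p * (x + y) * t                     ≡⟨ cong (λ z → p * z * t) (C-second-difference-odd c j) ⟩
      p * (fromℕ 2 * z + w) * t           ≡⟨ expand p z w t ⟩
      fromℕ 2 * (p * z * t) + p * w * t   ∎
      where
      p = (- fromℕ 4) ^ℚ j
      t = T (suc k ∸ j)
      x = fromℕ (suc (suc c) C suc (dbl j))
      y = fromℕ (c C suc (dbl j))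
      z = fromℕ (suc c C suc (dbl j))
      w = fromℕ (C-previous-odd c j)
      factor : ∀ p x y t → p * x * t + p * y * t ≡ p * (x + y) * t
      factor = solve-∀ ℚ-ring
      expand : ∀ p z w t → p * (fromℕ 2 * z + w) * t ≡ fromℕ 2 * (p * z * t) + p * w * t
      expand = solve-∀ ℚ-ring
    carries : Σ≤ (suc k) carry ≡ (- fromℕ 4) * U c k
    carries = begin
      Σ≤ (suc k) carry
        ≡⟨ Σ≤-head k carry ⟩
      1ℚ * 0ℚ * T (suc k) + Σ≤ k (λ j → carry (suc j))
        ≡⟨ cong₂ _+_ (ℚ.*-zeroˡ (T (suc k))) (Σ≤-cong k (λ j → reassoc (- fromℕ 4) ((- fromℕ 4) ^ℚ j) _ _)) ⟩
      0ℚ + Σ≤ k (λ j → (- fromℕ 4) * ((- fromℕ 4) ^ℚ j * fromℕ (c C suc (dbl j)) * T (k ∸ j)))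
        ≡⟨ trans (ℚ.+-identityˡ _) (Σ≤-*ˡ k (- fromℕ 4) _) ⟩
      (- fromℕ 4) * U c k
        ∎
      where
      reassoc : ∀ m p x t → m * p * x * t ≡ m * (p * x * t)
      reassoc = solve-∀ ℚ-ring

  level : ℕ → ℕ → ℚ
  level s q with evenN s
  ... | true  = ¼ ^ℚ half s * U (suc q) (half s)
  ... | false = 0ℚ

  level-even : ∀ k q → level (dbl k) q ≡ ¼ ^ℚ k * U (suc q) k
  level-even k q rewrite evenN-dbl k | half-dbl k = refl

  level-odd : ∀ k q → level (suc (dbl k)) q ≡ 0ℚ
  level-odd k q rewrite evenN-suc-dbl k = refl

  green : ℕ → ℕ → ℚ
  green p q = level (p ℕ.+ q) q

  origin : ℕ → ℕ → ℚ
  origin zero zero = 1ℚ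
  origin _    _    = 0ℚ

  ¼^k≡4*¼^[1+k] : ∀ k → ¼ ^ℚ k ≡ fromℕ 4 * ¼ ^ℚ suc k
  ¼^k≡4*¼^[1+k] k = sym (trans (sym (ℚ.*-assoc (fromℕ 4) ¼ (¼ ^ℚ k))) (ℚ.*-identityˡ (¼ ^ℚ k)))

  level-interior : ∀ s q → level (suc (suc s)) (suc q) ≡ ½ * (level (suc (suc s)) q + level s q + level (suc (suc s)) (suc (suc q)))
  level-interior s q = by-parity s (parity s)
    where
    open ≡-Reasoning
    by-parity : ∀ s → Parity s → level (suc (suc s)) (suc q) ≡ ½ * (level (suc (suc s)) q + level s q + level (suc (suc s)) (suc (suc q)))
    by-parity _ (odd k) = begin
      level (suc (dbl (suc k))) (suc q)                      ≡⟨ level-odd (suc k) (suc q) ⟩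
      0ℚ                                                     ≡⟨ cong₂ (λ x y → ½ * (x + y + 0ℚ)) (level-odd (suc k) q) (level-odd k q) ⟨
      ½ * (level (suc (dbl (suc k))) q + level (suc (dbl k)) q + 0ℚ)
        ≡⟨ cong (λ x → ½ * (level (suc (dbl (suc k))) q + level (suc (dbl k)) q + x)) (level-odd (suc k) (suc (suc q))) ⟨
      ½ * (level (suc (dbl (suc k))) q + level (suc (dbl k)) q + level (suc (dbl (suc k))) (suc (suc q)))  ∎
    by-parity _ (even k) = begin
      level (dbl (suc k)) (suc q)                 ≡⟨ level-even (suc k) (suc q) ⟩
      w * X                                       ≡⟨ isolate w X D ⟩
      ½ * (w * ((fromℕ 2 * X + (- fromℕ 4) * D) + fromℕ 4 * D))
        ≡⟨ cong (λ z → ½ * (w * (z + fromℕ 4 * D))) (U-second-difference (suc q) k) ⟨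
      ½ * (w * ((A + B) + fromℕ 4 * D))           ≡⟨ distribute w A B D ⟩
      ½ * (w * B + fromℕ 4 * w * D + w * A)       ≡⟨ cong (λ z → ½ * (w * B + z * D + w * A)) (¼^k≡4*¼^[1+k] k) ⟨
      ½ * (w * B + ¼ ^ℚ k * D + w * A)
        ≡⟨ cong₂ (λ x y → ½ * (x + y + w * A)) (level-even (suc k) q) (level-even k q) ⟨
      ½ * (level (dbl (suc k)) q + level (dbl k) q + w * A)
        ≡⟨ cong (λ x → ½ * (level (dbl (suc k)) q + level (dbl k) q + x)) (level-even (suc k) (suc (suc q))) ⟨
      ½ * (level (dbl (suc k)) q + level (dbl k) q + level (dbl (suc k)) (suc (suc q)))  ∎
      where
      w = ¼ ^ℚ suc k
      A = U (suc (suc (suc q))) (suc k)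
      B = U (suc q) (suc k)
      X = U (suc (suc q)) (suc k)
      D = U (suc q) k
      isolate : ∀ w X D → w * X ≡ ½ * (w * ((fromℕ 2 * X + (- fromℕ 4) * D) + fromℕ 4 * D))
      isolate = solve-∀ ℚ-ring
      distribute : ∀ w A B D → ½ * (w * ((A + B) + fromℕ 4 * D)) ≡ ½ * (w * B + fromℕ 4 * w * D + w * A)
      distribute = solve-∀ ℚ-ring

  level-left-edge : ∀ q → level (suc q) (suc q) ≡ ½ * level (suc q) q
  level-left-edge q = by-parity q (parity q)
    where
    open ≡-Reasoning
    by-parity : ∀ q → Parity q → level (suc q) (suc q) ≡ ½ * level (suc q) q
    by-parity _ (even t) = trans (level-odd t _) (sym (trans (cong (½ *_) (level-odd t _)) (ℚ.*-zeroʳ ½)))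
    by-parity _ (odd t)  = begin
      level (dbl (suc t)) (suc (suc (dbl t)))           ≡⟨ level-even (suc t) _ ⟩
      w * X                                             ≡⟨ isolate w X D ⟩
      ½ * (w * ((fromℕ 2 * X + (- fromℕ 4) * D) + fromℕ 4 * D))
        ≡⟨ cong (λ z → ½ * (w * (z + fromℕ 4 * D))) (U-second-difference (dbl (suc t)) t) ⟨
      ½ * (w * ((A + B) + fromℕ 4 * D))
        ≡⟨ cong₂ (λ x y → ½ * (w * ((x + B) + fromℕ 4 * y))) (tangent-binomial (suc t)) (tangent-binomial t) ⟩
      ½ * (w * ((fromℕ 2 * ((- fromℕ 4) * p) + B) + fromℕ 4 * (fromℕ 2 * p)))
        ≡⟨ cancel w B p ⟩
      ½ * (w * B)                                       ≡⟨ cong (½ *_) (level-even (suc t) _) ⟨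
      ½ * level (dbl (suc t)) (suc (dbl t))             ∎
      where
      w = ¼ ^ℚ suc t
      p = (- fromℕ 4) ^ℚ t
      A = U (dbl (suc (suc t))) (suc t)
      B = U (dbl (suc t)) (suc t)
      X = U (suc (dbl (suc t))) (suc t)
      D = U (dbl (suc t)) t
      isolate : ∀ w X D → w * X ≡ ½ * (w * ((fromℕ 2 * X + (- fromℕ 4) * D) + fromℕ 4 * D))
      isolate = solve-∀ ℚ-ring
      cancel : ∀ w B p → ½ * (w * ((fromℕ 2 * ((- fromℕ 4) * p) + B) + fromℕ 4 * (fromℕ 2 * p))) ≡ ½ * (w * B)
      cancel = solve-∀ ℚ-ring

  level-bottom-edge : ∀ s → level (suc s) 0 ≡ ½ * level (suc s) 1
  level-bottom-edge s = by-parity s (parity s)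
    where
    open ≡-Reasoning
    by-parity : ∀ s → Parity s → level (suc s) 0 ≡ ½ * level (suc s) 1
    by-parity _ (even t) = trans (level-odd t 0) (sym (trans (cong (½ *_) (level-odd t 1)) (ℚ.*-zeroʳ ½)))
    by-parity _ (odd t)  = begin
      level (dbl (suc t)) 0                             ≡⟨ level-even (suc t) 0 ⟩
      w * X                                             ≡⟨ isolate w X ⟩
      ½ * (w * ((fromℕ 2 * X + (- fromℕ 4) * 0ℚ) + 0ℚ))
        ≡⟨ cong₂ (λ y z → ½ * (w * ((fromℕ 2 * X + (- fromℕ 4) * y) + z))) (U-0 t) (U-0 (suc t)) ⟨
      ½ * (w * ((fromℕ 2 * X + (- fromℕ 4) * U 0 t) + U 0 (suc t)))
        ≡⟨ cong (λ z → ½ * (w * (z + U 0 (suc t)))) (U-second-difference 0 t) ⟨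
      ½ * (w * ((A + U 0 (suc t)) + U 0 (suc t)))
        ≡⟨ cong (λ z → ½ * (w * ((A + z) + z))) (U-0 (suc t)) ⟩
      ½ * (w * ((A + 0ℚ) + 0ℚ))                         ≡⟨ drop w A ⟩
      ½ * (w * A)                                       ≡⟨ cong (½ *_) (level-even (suc t) 1) ⟨
      ½ * level (dbl (suc t)) 1                         ∎
      where
      w = ¼ ^ℚ suc t
      A = U 2 (suc t)
      X = U 1 (suc t)
      isolate : ∀ w X → w * X ≡ ½ * (w * ((fromℕ 2 * X + (- fromℕ 4) * 0ℚ) + 0ℚ))
      isolate = solve-∀ ℚ-ring
      drop : ∀ w A → ½ * (w * ((A + 0ℚ) + 0ℚ)) ≡ ½ * (w * A)
      drop = solve-∀ ℚ-ring

  green-harmonic : ∀ p q → green p q ≡ origin p q + ½ * backward green p q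
  green-harmonic zero    zero    = trans (ℚ.*-identityˡ (U 1 0)) (trans (U-1 0) T0≡1)
  green-harmonic zero    (suc q) = trans (level-left-edge q) (pad (level (suc q) q))
    where
    pad : ∀ x → ½ * x ≡ 0ℚ + ½ * ((x + 0ℚ) + 0ℚ)
    pad = solve-∀ ℚ-ring
  green-harmonic (suc p) zero    = begin
    level (suc (p ℕ.+ 0)) 0                   ≡⟨ cong (λ s → level (suc s) 0) (ℕ.+-identityʳ p) ⟩
    level (suc p) 0                           ≡⟨ level-bottom-edge p ⟩
    ½ * level (suc p) 1                       ≡⟨ cong (λ s → ½ * level s 1) (ℕ.+-comm 1 p) ⟩
    ½ * level (p ℕ.+ 1) 1                     ≡⟨ pad (level (p ℕ.+ 1) 1) ⟩
    0ℚ + ½ * ((0ℚ + 0ℚ) + level (p ℕ.+ 1) 1)  ∎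
    where
    open ≡-Reasoning
    pad : ∀ x → ½ * x ≡ 0ℚ + ½ * ((0ℚ + 0ℚ) + x)
    pad = solve-∀ ℚ-ring
  green-harmonic (suc p) (suc q) = begin
    level (suc (p ℕ.+ suc q)) (suc q)
      ≡⟨ cong (λ s → level (suc s) (suc q)) (ℕ.+-suc p q) ⟩
    level (suc (suc (p ℕ.+ q))) (suc q)
      ≡⟨ level-interior (p ℕ.+ q) q ⟩
    ½ * (level (suc (suc (p ℕ.+ q))) q + level (p ℕ.+ q) q + level (suc (suc (p ℕ.+ q))) (suc (suc q)))
      ≡⟨ cong (λ s → ½ * (level (suc (suc (p ℕ.+ q))) q + level (p ℕ.+ q) q + level s (suc (suc q)))) two-up ⟨
    ½ * (level (suc (suc (p ℕ.+ q))) q + level (p ℕ.+ q) q + level (p ℕ.+ suc (suc q)) (suc (suc q)))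
      ≡⟨ sym (ℚ.+-identityˡ _) ⟩
    0ℚ + ½ * backward green (suc p) (suc q)
      ∎
    where
    open ≡-Reasoning
    two-up : p ℕ.+ suc (suc q) ≡ suc (suc (p ℕ.+ q))
    two-up = trans (ℕ.+-suc p (suc q)) (cong suc (ℕ.+-suc p q))

  green-on-axis : ∀ i → green i 0 ≡ tanForm a i
  green-on-axis i = trans (cong (λ s → level s 0) (ℕ.+-identityʳ i)) (by-parity i (parity i))
    where
    by-parity : ∀ i → Parity i → level i 0 ≡ tanForm a i
    by-parity _ (even k) = trans (level-even k 0) (trans (cong (¼ ^ℚ k *_) (U-1 k))
                             (trans (ℚ.*-comm (¼ ^ℚ k) (T k)) (sym (tanForm-even k))))
    by-parity _ (odd k)  = trans (level-odd k 0) (sym (tanForm-odd k))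

module Potential (I : ℕ) where

  open import Data.Nat using (zero; suc; _+_; _*_; _^_; _≤_; pred; s≤s; z≤n)
  import Data.Nat.Properties as ℕ
  open import Data.Nat.Tactic.RingSolver using (solve-∀)
  open import Relation.Binary.PropositionalEquality
  open Walks using (module StepSums; backward-homomorphic)
  open Binomial using (bernoulli-inequality)
  open StepSums ℕ.+-0-commutativeMonoid using (backward; backward-∙; backward-mono-on)

  K : ℕ
  K = suc I

  K² : ℕ
  K² = K * K

  potential : ℕ → ℕ → ℕ
  potential p q = K ^ (p + q) * (suc p * suc q)

  -- The factor K² avoids the negative power K^(p+q-2) of the lower neighbour (p-1, q-1); on the axes the
  -- missing neighbours are exactly those where the right-hand side's formula would contribute 0.
  K²*backward-potential : ∀ p q →
    K² * backward potential p q ≡ K ^ (p + q) * (K² * (suc (suc p) * q + p * suc (suc q)) + p * q)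
  K²*backward-potential zero    zero    = identity K
    where
    identity : ∀ k → k * k * ((0 + 0) + 0) ≡ 1 * (k * k * (2 * 0 + 0 * 2) + 0 * 0)
    identity = solve-∀
  K²*backward-potential zero    (suc q) = identity K (K ^ q) q
    where
    identity : ∀ k w q → k * k * ((k * w * (2 * suc q) + 0) + 0) ≡ k * w * (k * k * (2 * suc q + 0 * suc (suc (suc q))) + 0 * suc q)
    identity = solve-∀
  K²*backward-potential (suc p) zero
    rewrite ℕ.+-identityʳ p | ℕ.+-comm p 1 = identity K (K ^ p) p
    where
    identity : ∀ k w p → k * k * ((0 + 0) + k * w * (suc p * 2)) ≡ k * w * (k * k * (suc (suc (suc p)) * 0 + suc p * 2) + suc p * 0)
    identity = solve-∀
  K²*backward-potential (suc p) (suc q)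
    rewrite ℕ.+-suc p (suc q) | ℕ.+-suc p q = identity K (K ^ (p + q)) p q
    where
    identity : ∀ k w p q →
      k * k * ((k * (k * w) * (suc (suc (suc p)) * suc q) + w * (suc p * suc q)) + k * (k * w) * (suc p * suc (suc (suc q))))
      ≡ k * (k * w) * (k * k * (suc (suc (suc p)) * suc q + suc p * suc (suc (suc q))) + suc p * suc q)
    identity = solve-∀

  potential-contraction : ∀ p q → p + q ≤ I → K² * backward potential p q + potential p q ≤ 2 * K² * potential p q
  potential-contraction p q p+q≤I = ℕ.*-cancelˡ-≤ K² (begin
    K² * (K² * backward potential p q + potential p q)
      ≡⟨ expand K² (backward potential p q) (potential p q) ⟩
    K² * (K² * backward potential p q) + K² * potential p q
      ≡⟨ cong (λ x → K² * x + K² * potential p q) (K²*backward-potential p q) ⟩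
    K² * (W * (K² * X + p * q)) + K² * (W * (suc p * suc q))
      ≡⟨ factor K² W X (p * q) (suc p * suc q) ⟩
    K² * W * (K² * X + (p * q + suc p * suc q))
      ≤⟨ ℕ.*-monoʳ-≤ (K² * W) (ℕ.+-monoʳ-≤ (K² * X) corner-bound) ⟩
    K² * W * (K² * X + 2 * K²)
      ≡⟨ recombine K² W p q ⟩
    K² * (2 * K² * potential p q)
      ∎)
    where
    open ℕ.≤-Reasoning
    W = K ^ (p + q)
    X = suc (suc p) * q + p * suc (suc q)
    1+p≤K : suc p ≤ K
    1+p≤K = s≤s (ℕ.≤-trans (ℕ.m≤m+n p q) p+q≤I)
    1+q≤K : suc q ≤ K
    1+q≤K = s≤s (ℕ.≤-trans (ℕ.m≤n+m q p) p+q≤I)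
    corner-bound : p * q + suc p * suc q ≤ 2 * K²
    corner-bound = ℕ.≤-trans (ℕ.+-mono-≤ (ℕ.*-mono-≤ (ℕ.n≤1+n p) (ℕ.n≤1+n q)) (ℕ.*-mono-≤ 1+p≤K 1+q≤K))
                             (ℕ.+-mono-≤ (ℕ.*-mono-≤ 1+p≤K 1+q≤K) (ℕ.≤-reflexive (sym (ℕ.+-identityʳ K²))))
    expand : ∀ g b c → g * (g * b + c) ≡ g * (g * b) + g * c
    expand = solve-∀
    factor : ∀ g w x y z → g * (w * (g * x + y)) + g * (w * z) ≡ g * w * (g * x + (y + z))
    factor = solve-∀
    recombine : ∀ g w p q → g * w * (g * (suc (suc p) * q + p * suc (suc q)) + 2 * g) ≡ g * (2 * g * (w * (suc p * suc q)))
    recombine = solve-∀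

  iterate : ℕ → ℕ → ℕ → ℕ
  iterate zero    = potential
  iterate (suc M) = backward (iterate M)

  backward-scale : ∀ c f p q → backward (λ i j → c * f i j) p q ≡ c * backward f p q
  backward-scale c f p q = sym (backward-homomorphic ℕ.+-0-commutativeMonoid ℕ.+-0-commutativeMonoid (c *_)
                                  (ℕ.*-zeroʳ c) (ℕ.*-distribˡ-+ c) f p q)

  iterate-contraction : ∀ M p q → p + q ≤ I → K² * iterate (suc M) p q + iterate M p q ≤ 2 * K² * iterate M p q
  iterate-contraction zero    = potential-contraction
  iterate-contraction (suc M) p q p+q≤I = begin
    K² * backward (iterate (suc M)) p q + backward (iterate M) p q
      ≡⟨ cong (_+ backward (iterate M) p q) (backward-scale K² (iterate (suc M)) p q) ⟨
    backward (λ i j → K² * iterate (suc M) i j) p q + backward (iterate M) p q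
      ≡⟨ backward-∙ (λ i j → K² * iterate (suc M) i j) (iterate M) p q ⟨
    backward (λ i j → K² * iterate (suc M) i j + iterate M i j) p q
      ≤⟨ backward-mono-on _≤_ z≤n ℕ.+-mono-≤ I (iterate-contraction M) p q p+q≤I ⟩
    backward (λ i j → 2 * K² * iterate M i j) p q
      ≡⟨ backward-scale (2 * K²) (iterate M) p q ⟩
    2 * K² * backward (iterate M) p q
      ∎
    where open ℕ.≤-Reasoning

  D : ℕ
  D = K² + pred K²

  1+D≡2*K² : suc D ≡ 2 * K²
  1+D≡2*K² = identity (pred K²)
    where
    identity : ∀ g → suc (suc g + g) ≡ 2 * suc g
    identity = solve-∀

  iterate-decay : ∀ M p q → p + q ≤ I → K² ^ M * iterate M p q ≤ D ^ M * potential p q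
  iterate-decay zero    p q _     = ℕ.≤-refl
  iterate-decay (suc M) p q p+q≤I = begin
    K² * K² ^ M * iterate (suc M) p q      ≡⟨ swap K² (K² ^ M) (iterate (suc M) p q) ⟩
    K² ^ M * (K² * iterate (suc M) p q)    ≤⟨ ℕ.*-monoʳ-≤ (K² ^ M) one-step ⟩
    K² ^ M * (D * iterate M p q)           ≡⟨ swap′ (K² ^ M) D (iterate M p q) ⟩
    D * (K² ^ M * iterate M p q)           ≤⟨ ℕ.*-monoʳ-≤ D (iterate-decay M p q p+q≤I) ⟩
    D * (D ^ M * potential p q)            ≡⟨ ℕ.*-assoc D (D ^ M) (potential p q) ⟨
    D * D ^ M * potential p q              ∎
    where
    open ℕ.≤-Reasoning
    swap : ∀ g h v → g * h * v ≡ h * (g * v)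
    swap = solve-∀
    swap′ : ∀ h d v → h * (d * v) ≡ d * (h * v)
    swap′ = solve-∀
    one-step : K² * iterate (suc M) p q ≤ D * iterate M p q
    one-step = ℕ.+-cancelʳ-≤ (iterate M p q) _ _ (ℕ.≤-trans (iterate-contraction M p q p+q≤I)
      (ℕ.≤-reflexive (trans (cong (_* iterate M p q) (sym 1+D≡2*K²)) (ℕ.+-comm (iterate M p q) (D * iterate M p q)))))

  iterate-bound : ∀ M p q → p + q ≤ I → iterate M p q * (suc D + M) ≤ potential p q * suc D * 2 ^ M
  iterate-bound M p q p+q≤I = ℕ.*-cancelˡ-≤ (K² ^ M) {{ℕ.m^n≢0 K² M}} (begin
    K² ^ M * (iterate M p q * (suc D + M))      ≡⟨ ℕ.*-assoc (K² ^ M) (iterate M p q) (suc D + M) ⟨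
    K² ^ M * iterate M p q * (suc D + M)        ≤⟨ ℕ.*-monoˡ-≤ (suc D + M) (iterate-decay M p q p+q≤I) ⟩
    D ^ M * potential p q * (suc D + M)         ≡⟨ swap (D ^ M) (potential p q) (suc D + M) ⟩
    potential p q * (D ^ M * (suc D + M))       ≤⟨ ℕ.*-monoʳ-≤ (potential p q) (bernoulli-inequality D M) ⟩
    potential p q * (suc D * suc D ^ M)         ≡⟨ cong (λ x → potential p q * (suc D * x ^ M)) 1+D≡2*K² ⟩
    potential p q * (suc D * (2 * K²) ^ M)      ≡⟨ cong (λ x → potential p q * (suc D * x)) (^-distrib-* 2 K² M) ⟩
    potential p q * (suc D * (2 ^ M * K² ^ M))  ≡⟨ regroup (potential p q) (suc D) (2 ^ M) (K² ^ M) ⟩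
    K² ^ M * (potential p q * suc D * 2 ^ M)    ∎)
    where
    open ℕ.≤-Reasoning
    swap : ∀ d g s → d * g * s ≡ g * (d * s)
    swap = solve-∀
    regroup : ∀ g d t h → g * (d * (t * h)) ≡ h * (g * d * t)
    regroup = solve-∀
    ^-distrib-* : ∀ m n k → (m * n) ^ k ≡ m ^ k * n ^ k
    ^-distrib-* m n zero    = refl
    ^-distrib-* m n (suc k) = trans (cong (m * n *_) (^-distrib-* m n k)) (interchange m n (m ^ k) (n ^ k))
      where
      interchange : ∀ a b c d → a * b * (c * d) ≡ a * c * (b * d)
      interchange = solve-∀

  1≤potential : ∀ p q → 1 ≤ potential p q
  1≤potential p q = ℕ.*-mono-≤ (ℕ.m^n>0 K (p + q)) (ℕ.*-mono-≤ (s≤s (z≤n {p})) (s≤s (z≤n {q})))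

module Convergence where

  open import Data.Nat as ℕ using (ℕ; suc)
  import Data.Nat.Properties as ℕ
  open import Data.Product using (_,_; proj₁; proj₂)
  open import Data.Rational as ℚ using (ℚ; _+_; _*_; -_; _-_; _≤_; _<_; ∣_∣; 1/_)
  open import Data.Rational.Properties
  open import Relation.Binary.PropositionalEquality
  open RationalRingSolver using (solve-∀; ℚ-ring)
  open Rationals using (archimedean; fromℕ-mono-≤; 0≤fromℕ)
  open FiniteSums using (Σ<-cong)

  converges-if-remainder-O[1/M] : ∀ (a : ℕ → ℚ) L (R : ℕ → ℚ) B →
    (∀ M → Σ< M a + R M ≡ L) → (∀ M → ∣ R M ∣ * fromℕ (suc M) ≤ B) → SeriesConvergesTo a L
  converges-if-remainder-O[1/M] a L R B Σ+R≡L ∣R∣*[1+M]≤B ε ε>0 =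
    N , λ M N≤M → subst (_< ε) (sym (error≡∣R∣ M)) (∣R∣<ε M N≤M)
    where
    instance
      ε-positive : ℚ.Positive ε
      ε-positive = ℚ.positive ε>0
      ε-nonZero : ℚ.NonZero ε
      ε-nonZero = pos⇒nonZero ε
    N : ℕ
    N = proj₁ (archimedean (B * 1/ ε))
    B<N*ε : B < fromℕ N * ε
    B<N*ε = ≤-<-trans (≤-reflexive (sym (trans (*-assoc B (1/ ε) ε) (trans (cong (B *_) (*-inverseˡ ε)) (*-identityʳ B)))))
                      (*-monoˡ-<-pos ε (proj₂ (archimedean (B * 1/ ε))))
    error≡∣R∣ : ∀ M → ∣ Σ< M a - L ∣ ≡ ∣ R M ∣
    error≡∣R∣ M = trans (cong (λ l → ∣ Σ< M a - l ∣) (sym (Σ+R≡L M)))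
                        (trans (cong ∣_∣ (cancel (Σ< M a) (R M))) (∣-p∣≡∣p∣ (R M)))
      where
      cancel : ∀ s r → s - (s + r) ≡ - r
      cancel = solve-∀ ℚ-ring
    ∣R∣<ε : ∀ M → N ℕ.≤ M → ∣ R M ∣ < ε
    ∣R∣<ε M N≤M = *-cancelʳ-<-nonNeg (fromℕ (suc M)) {{ℚ.nonNegative (0≤fromℕ (suc M))}} (begin-strict
      ∣ R M ∣ * fromℕ (suc M)    ≤⟨ ∣R∣*[1+M]≤B M ⟩
      B                          <⟨ B<N*ε ⟩
      fromℕ N * ε
        ≤⟨ *-monoʳ-≤-nonNeg ε {{ℚ.nonNegative (<⇒≤ ε>0)}} (fromℕ-mono-≤ (ℕ.≤-trans N≤M (ℕ.n≤1+n M))) ⟩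
      fromℕ (suc M) * ε          ≡⟨ *-comm (fromℕ (suc M)) ε ⟩
      ε * fromℕ (suc M)          ∎)
      where open ≤-Reasoning

  SeriesConvergesTo-cong : ∀ {a a′ : ℕ → ℚ} {L} → (∀ n → a n ≡ a′ n) → SeriesConvergesTo a L → SeriesConvergesTo a′ L
  SeriesConvergesTo-cong {L = L} a≡a′ a→L ε ε>0 with a→L ε ε>0
  ... | N , close = N , λ M N≤M → subst (λ s → ∣ s - L ∣ < ε) (Σ<-cong M a≡a′) (close M N≤M)

module WalkSeries (a : ℕ → ℚ) (a-tan : IsTanSeries a) where

  open import Data.Nat as ℕ using (ℕ; zero; suc; _∸_)
  import Data.Nat.Properties as ℕ
  open import Data.Rational as ℚ using (ℚ; 0ℚ; 1ℚ; ½; _+_; _*_; _≤_; ∣_∣)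
  import Data.Rational.Properties as ℚ
  open import Relation.Binary.PropositionalEquality
  open RationalRingSolver using (solve-∀; ℚ-ring)
  open FiniteSums
  open Rationals
  open import Data.Maybe using (just; nothing)
  open import Data.Product using (_,_)
  open Walks using (premove; count; count-last-step; walkCount≡count; module StepSums; backward-homomorphic)
  open GreenFunction a a-tan using (green; origin; green-harmonic)
  open Convergence using (converges-if-remainder-O[1/M])
  open StepSums ℚ.+-0-commutativeMonoid using (at; backward; backward-ε; backward-∙; backward-cong; backward-mono-on)
  module ℕ-Steps = StepSums ℕ.+-0-commutativeMonoid

  backward-fromℕ : ∀ f p q → fromℕ (ℕ-Steps.backward f p q) ≡ backward (λ i j → fromℕ (f i j)) p q
  backward-fromℕ = backward-homomorphic ℕ.+-0-commutativeMonoid ℚ.+-0-commutativeMonoid fromℕ refl fromℕ-+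

  backward-*ʳ : ∀ c f p q → backward f p q * c ≡ backward (λ i j → f i j * c) p q
  backward-*ʳ c = backward-homomorphic ℚ.+-0-commutativeMonoid ℚ.+-0-commutativeMonoid (_* c) (ℚ.*-zeroˡ c) (λ x y → ℚ.*-distribʳ-+ c x y)

  backward-*ˡ : ∀ c f p q → c * backward f p q ≡ backward (λ i j → c * f i j) p q
  backward-*ˡ c = backward-homomorphic ℚ.+-0-commutativeMonoid ℚ.+-0-commutativeMonoid (c *_) (ℚ.*-zeroʳ c) (ℚ.*-distribˡ-+ c)

  backward-Σ< : ∀ M (f : ℕ → ℕ → ℕ → ℚ) p q → Σ< M (λ n → backward (f n) p q) ≡ backward (λ i j → Σ< M (λ n → f n i j)) p q
  backward-Σ< zero    f p q = sym (backward-ε p q)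
  backward-Σ< (suc M) f p q = trans (cong (_+ backward (f M) p q) (backward-Σ< M f p q))
                                    (sym (backward-∙ (λ i j → Σ< M (λ n → f n i j)) (f M) p q))

  partial-sum : ℕ → ℕ → ℕ → ℚ
  partial-sum M p q = Σ< M (λ n → fromℕ (count n 0 0 p q) * ½ ^ℚ n)

  partial-sum-suc : ∀ M p q → partial-sum (suc M) p q ≡ origin p q + ½ * backward (partial-sum M) p q
  partial-sum-suc M p q = begin
    Σ< (suc M) (λ n → t n p q)                                ≡⟨ Σ<-head M (λ n → t n p q) ⟩
    t 0 p q + Σ< M (λ n → t (suc n) p q)                      ≡⟨ cong₂ _+_ (start p q) (Σ<-cong M step) ⟩
    origin p q + Σ< M (λ n → ½ * backward (t n) p q)          ≡⟨ cong (origin p q +_) (Σ<-*ˡ M ½ (λ n → backward (t n) p q)) ⟩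
    origin p q + ½ * Σ< M (λ n → backward (t n) p q)          ≡⟨ cong (λ x → origin p q + ½ * x) (backward-Σ< M t p q) ⟩
    origin p q + ½ * backward (partial-sum M) p q                 ∎
    where
    open ≡-Reasoning
    t : ℕ → ℕ → ℕ → ℚ
    t n p q = fromℕ (count n 0 0 p q) * ½ ^ℚ n
    start : ∀ p q → t 0 p q ≡ origin p q
    start zero    zero    = refl
    start zero    (suc q) = refl
    start (suc p) q       = refl
    step : ∀ n → t (suc n) p q ≡ ½ * backward (t n) p q
    step n = begin
      fromℕ (count (suc n) 0 0 p q) * (½ * ½ ^ℚ n)
        ≡⟨ cong (λ k → fromℕ k * (½ * ½ ^ℚ n)) (count-last-step n 0 0 p q) ⟩
      fromℕ (ℕ-Steps.backward (count n 0 0) p q) * (½ * ½ ^ℚ n)          ≡⟨ cong (_* (½ * ½ ^ℚ n)) (backward-fromℕ (count n 0 0) p q) ⟩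
      backward (λ i j → fromℕ (count n 0 0 i j)) p q * (½ * ½ ^ℚ n)
        ≡⟨ reassoc (backward (λ i j → fromℕ (count n 0 0 i j)) p q) ½ (½ ^ℚ n) ⟩
      ½ * (backward (λ i j → fromℕ (count n 0 0 i j)) p q * ½ ^ℚ n)     ≡⟨ cong (½ *_) (backward-*ʳ (½ ^ℚ n) _ p q) ⟩
      ½ * backward (t n) p q                                            ∎
      where
      reassoc : ∀ x h p → x * (h * p) ≡ h * (x * p)
      reassoc = solve-∀ ℚ-ring

  remainder : ℕ → ℕ → ℕ → ℚ
  remainder zero          = green
  remainder (suc M) p q   = ½ * backward (remainder M) p q

  partial-sum+remainder≡green : ∀ M p q → partial-sum M p q + remainder M p q ≡ green p q
  partial-sum+remainder≡green zero    p q = ℚ.+-identityˡ (green p q)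
  partial-sum+remainder≡green (suc M) p q = begin
    partial-sum (suc M) p q + ½ * backward (remainder M) p q
      ≡⟨ cong (_+ ½ * backward (remainder M) p q) (partial-sum-suc M p q) ⟩
    origin p q + ½ * backward (partial-sum M) p q + ½ * backward (remainder M) p q
      ≡⟨ factor (origin p q) (backward (partial-sum M) p q) (backward (remainder M) p q) ⟩
    origin p q + ½ * (backward (partial-sum M) p q + backward (remainder M) p q)
      ≡⟨ cong (λ x → origin p q + ½ * x) (backward-∙ (partial-sum M) (remainder M) p q) ⟨
    origin p q + ½ * backward (λ i j → partial-sum M i j + remainder M i j) p q
      ≡⟨ cong (λ x → origin p q + ½ * x) (backward-cong (partial-sum+remainder≡green M) p q) ⟩
    origin p q + ½ * backward green p q
      ≡⟨ green-harmonic p q ⟨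
    green p q
      ∎
    where
    open ≡-Reasoning
    factor : ∀ o x y → o + ½ * x + ½ * y ≡ o + ½ * (x + y)
    factor = solve-∀ ℚ-ring

  backward-∣∣ : ∀ f p q → ∣ backward f p q ∣ ≤ backward (λ i j → ∣ f i j ∣) p q
  backward-∣∣ f p q = ℚ.≤-trans (ℚ.∣p+q∣≤∣p∣+∣q∣ (at′ NW + at′ NE) (at′ SE))
    (ℚ.+-mono-≤ (ℚ.≤-trans (ℚ.∣p+q∣≤∣p∣+∣q∣ (at′ NW) (at′ NE)) (ℚ.+-mono-≤ (at-∣∣ NW) (at-∣∣ NE))) (at-∣∣ SE))
    where
    at′ : Step → ℚ
    at′ s = at (premove s p q) f
    at-∣∣ : ∀ s → ∣ at (premove s p q) f ∣ ≤ at (premove s p q) (λ i j → ∣ f i j ∣)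
    at-∣∣ s with premove s p q
    ... | nothing      = ℚ.≤-refl
    ... | just (i , j) = ℚ.≤-refl

  module _ (I : ℕ) where

    open Potential I using (potential; iterate; D; iterate-bound; 1≤potential)

    Σ∣green∣ : ℚ
    Σ∣green∣ = Σ≤ I (λ s → Σ≤ s (λ p → ∣ green p (s ∸ p) ∣))

    0≤Σ∣green∣ : 0ℚ ≤ Σ∣green∣
    0≤Σ∣green∣ = Σ≤-nonNeg I _ (λ s → Σ≤-nonNeg s _ (λ p → ℚ.0≤∣p∣ (green p (s ∸ p))))

    ∣green∣≤Σ∣green∣ : ∀ p q → p ℕ.+ q ℕ.≤ I → ∣ green p q ∣ ≤ Σ∣green∣
    ∣green∣≤Σ∣green∣ p q p+q≤I = begin
      ∣ green p q ∣                                       ≡⟨ cong (λ r → ∣ green p r ∣) (ℕ.m+n∸m≡n p q) ⟨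
      ∣ green p (p ℕ.+ q ∸ p) ∣                           ≤⟨ term≤Σ≤ (p ℕ.+ q) _ (λ p′ → ℚ.0≤∣p∣ _) p (ℕ.m≤m+n p q) ⟩
      Σ≤ (p ℕ.+ q) (λ p′ → ∣ green p′ (p ℕ.+ q ∸ p′) ∣)
        ≤⟨ term≤Σ≤ I _ (λ s → Σ≤-nonNeg s _ (λ p′ → ℚ.0≤∣p∣ _)) (p ℕ.+ q) p+q≤I ⟩
      Σ∣green∣                                           ∎
      where open ℚ.≤-Reasoning

    remainder-bound : ∀ M p q → p ℕ.+ q ℕ.≤ I → ∣ remainder M p q ∣ ≤ Σ∣green∣ * (½ ^ℚ M * fromℕ (iterate M p q))
    remainder-bound zero    p q p+q≤I = begin
      ∣ green p q ∣                          ≤⟨ ∣green∣≤Σ∣green∣ p q p+q≤I ⟩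
      Σ∣green∣                              ≡⟨ ℚ.*-identityʳ Σ∣green∣ ⟨
      Σ∣green∣ * 1ℚ
        ≤⟨ ℚ.*-monoˡ-≤-nonNeg Σ∣green∣ {{ℚ.nonNegative 0≤Σ∣green∣}} (fromℕ-mono-≤ (1≤potential p q)) ⟩
      Σ∣green∣ * fromℕ (potential p q)      ≡⟨ cong (Σ∣green∣ *_) (ℚ.*-identityˡ _) ⟨
      Σ∣green∣ * (1ℚ * fromℕ (potential p q)) ∎
      where open ℚ.≤-Reasoning
    remainder-bound (suc M) p q p+q≤I = begin
      ∣ ½ * backward (remainder M) p q ∣
        ≡⟨ ℚ.∣p*q∣≡∣p∣*∣q∣ ½ (backward (remainder M) p q) ⟩
      ½ * ∣ backward (remainder M) p q ∣
        ≤⟨ ℚ.*-monoˡ-≤-nonNeg ½ (ℚ.≤-trans (backward-∣∣ (remainder M) p q)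
                                            (backward-mono-on _≤_ ℚ.≤-refl ℚ.+-mono-≤ I (remainder-bound M) p q p+q≤I)) ⟩
      ½ * backward (λ i j → Σ∣green∣ * (½ ^ℚ M * fromℕ (iterate M i j))) p q
        ≡⟨ cong (½ *_) (trans (cong (Σ∣green∣ *_) (backward-*ˡ (½ ^ℚ M) V p q))
                              (backward-*ˡ Σ∣green∣ (λ i j → ½ ^ℚ M * V i j) p q)) ⟨
      ½ * (Σ∣green∣ * (½ ^ℚ M * backward (λ i j → fromℕ (iterate M i j)) p q))
        ≡⟨ cong (λ x → ½ * (Σ∣green∣ * (½ ^ℚ M * x))) (backward-fromℕ (iterate M) p q) ⟨
      ½ * (Σ∣green∣ * (½ ^ℚ M * fromℕ (iterate (suc M) p q)))
        ≡⟨ reassoc ½ Σ∣green∣ (½ ^ℚ M) (fromℕ (iterate (suc M) p q)) ⟩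
      Σ∣green∣ * (½ ^ℚ suc M * fromℕ (iterate (suc M) p q))
        ∎
      where
      open ℚ.≤-Reasoning
      V : ℕ → ℕ → ℚ
      V i j = fromℕ (iterate M i j)
      reassoc : ∀ h c x v → h * (c * (x * v)) ≡ c * ((h * x) * v)
      reassoc = solve-∀ ℚ-ring

    remainder-O[1/M] : ∀ M → ∣ remainder M I 0 ∣ * fromℕ (suc M) ≤ Σ∣green∣ * fromℕ (potential I 0 ℕ.* suc D)
    remainder-O[1/M] M = begin
      ∣ R ∣ * fromℕ (suc M)
        ≤⟨ ℚ.*-monoˡ-≤-nonNeg ∣ R ∣ {{ℚ.nonNegative (ℚ.0≤∣p∣ R)}} (fromℕ-mono-≤ (ℕ.s≤s (ℕ.m≤n+m M D))) ⟩
      ∣ R ∣ * fromℕ (suc D ℕ.+ M)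
        ≤⟨ ℚ.*-monoʳ-≤-nonNeg (fromℕ (suc D ℕ.+ M)) {{ℚ.nonNegative (0≤fromℕ (suc D ℕ.+ M))}} (remainder-bound M I 0 I+0≤I) ⟩
      Σ∣green∣ * (½ ^ℚ M * fromℕ V) * fromℕ (suc D ℕ.+ M)
        ≡⟨ trans (cong (λ x → Σ∣green∣ * (½ ^ℚ M * x)) (fromℕ-* V (suc D ℕ.+ M)))
                 (reassoc Σ∣green∣ (½ ^ℚ M) (fromℕ V) (fromℕ (suc D ℕ.+ M))) ⟨
      Σ∣green∣ * (½ ^ℚ M * fromℕ (V ℕ.* (suc D ℕ.+ M)))
        ≤⟨ ℚ.*-monoˡ-≤-nonNeg Σ∣green∣ {{ℚ.nonNegative 0≤Σ∣green∣}}
             (ℚ.*-monoˡ-≤-nonNeg (½ ^ℚ M) {{ℚ.nonNegative (0≤½^n M)}} (fromℕ-mono-≤ (iterate-bound M I 0 I+0≤I))) ⟩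
      Σ∣green∣ * (½ ^ℚ M * fromℕ (G ℕ.* 2 ℕ.^ M))
        ≡⟨ cong (λ x → Σ∣green∣ * (½ ^ℚ M * x)) (fromℕ-* G (2 ℕ.^ M)) ⟩
      Σ∣green∣ * (½ ^ℚ M * (fromℕ G * fromℕ (2 ℕ.^ M)))
        ≡⟨ regroup Σ∣green∣ (½ ^ℚ M) (fromℕ G) (fromℕ (2 ℕ.^ M)) ⟩
      Σ∣green∣ * fromℕ G * (½ ^ℚ M * fromℕ (2 ℕ.^ M))
        ≡⟨ trans (cong (Σ∣green∣ * fromℕ G *_) (½^n*2^n≡1 M)) (ℚ.*-identityʳ _) ⟩
      Σ∣green∣ * fromℕ G
        ∎
      where
      open ℚ.≤-Reasoning
      R = remainder M I 0
      V = iterate M I 0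
      G = potential I 0 ℕ.* suc D
      I+0≤I : I ℕ.+ 0 ℕ.≤ I
      I+0≤I = ℕ.≤-reflexive (ℕ.+-identityʳ I)
      reassoc : ∀ c h v d → c * (h * (v * d)) ≡ c * (h * v) * d
      reassoc = solve-∀ ℚ-ring
      regroup : ∀ c h g t → c * (h * (g * t)) ≡ c * g * (h * t)
      regroup = solve-∀ ℚ-ring

  green-series : ∀ i → SeriesConvergesTo (QTerm ½ i) (green i 0)
  green-series i = converges-if-remainder-O[1/M] (QTerm ½ i) (green i 0) (λ M → remainder M i 0) _
                     sum+remainder (remainder-O[1/M] i)
    where
    sum+remainder : ∀ M → Σ< M (QTerm ½ i) + remainder M i 0 ≡ green i 0
    sum+remainder M = trans (cong (_+ remainder M i 0) (Σ<-cong M (λ n → cong (λ k → fromℕ k * ½ ^ℚ n) (walkCount≡count n i 0))))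
                            (partial-sum+remainder≡green M i 0)

module TangentBernoulli (a : ℕ → ℚ) (a-tan : IsTanSeries a) (b : ℕ → ℚ) (b-bern : IsBernoulliEGF b) where

  open import Data.Nat as ℕ using (ℕ; zero; suc; _!)
  import Data.Nat.Properties as ℕ
  open import Data.Integer as ℤ using ()
  open import Data.Rational using (ℚ; 0ℚ; 1ℚ; ½; _+_; _*_; -_; _/_)
  import Data.Rational.Properties as ℚ
  open import Relation.Binary.PropositionalEquality
  open RationalRingSolver using (solve-∀; ℚ-ring)
  open Rationals
  open Parity
  open PowerSeries
  open Exponential
  open Twist using (exp-1)
  open TangentNumbers a a-tan using (tanh; cosh⋆tanh≈sinh; T; T≡±[2m+1]!*tanh; tanForm-even)

  E : Ser
  E = expm1Coeff

  E≈exp-1 : E ≈ₛ exp 1ℚ ⊕ ⊝ 1ₛ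
  E≈exp-1 zero    = refl
  E≈exp-1 (suc n) = sym (trans (ℚ.+-identityʳ _) (exp-1 (suc n)))

  -- x / (e^x - 1) + x / 2 = (x/2) coth (x/2)
  γ : Ser
  γ = b ⊕ κ ½ ⋆ X

  E⋆γ : E ⋆ γ ≈ₛ κ ½ ⋆ X ⋆ (exp 1ℚ ⊕ 1ₛ)
  E⋆γ = begin
    E ⋆ (b ⊕ κ ½ ⋆ X)                          ≈⟨ ⋆-distribˡ-⊕ E b (κ ½ ⋆ X) ⟩
    E ⋆ b ⊕ E ⋆ (κ ½ ⋆ X)                      ≈⟨ ⊕-cong b-bern (⋆-congʳ (κ ½ ⋆ X) E≈exp-1) ⟩
    X ⊕ (exp 1ℚ ⊕ ⊝ 1ₛ) ⋆ (κ ½ ⋆ X)            ≈⟨ solve 2 (λ x e → x :+ (e :- con 1ℚ) :* (con ½ :* x) := con ½ :* x :* (e :+ con 1ℚ))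
                                                        (λ _ → refl) X (exp 1ℚ) ⟩
    κ ½ ⋆ X ⋆ (exp 1ℚ ⊕ 1ₛ)                    ∎
    where
    open ≈ₛ-Reasoning
    open SeriesSolver

  dilate-exp-1 : ∀ c → dilate c (exp 1ℚ) ≈ₛ exp c
  dilate-exp-1 c n = trans (dilate-exp c 1ℚ n) (cong (λ d → exp d n) (ℚ.*-identityʳ c))

  dilated-E⋆γ : ∀ c → (exp c ⊕ ⊝ 1ₛ) ⋆ dilate c γ ≈ₛ κ ½ ⋆ (κ c ⋆ X) ⋆ (exp c ⊕ 1ₛ)
  dilated-E⋆γ c = begin
    (exp c ⊕ ⊝ 1ₛ) ⋆ dilate c γ                 ≈⟨ ⋆-congʳ (dilate c γ) dilate-E ⟨
    dilate c E ⋆ dilate c γ                     ≈⟨ dilate-⋆ c E γ ⟨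
    dilate c (E ⋆ γ)                            ≈⟨ dilate-cong c E⋆γ ⟩
    dilate c (κ ½ ⋆ X ⋆ (exp 1ℚ ⊕ 1ₛ))          ≈⟨ dilate-⋆ c (κ ½ ⋆ X) (exp 1ℚ ⊕ 1ₛ) ⟩
    dilate c (κ ½ ⋆ X) ⋆ dilate c (exp 1ℚ ⊕ 1ₛ) ≈⟨ ⋆-cong (≈ₛ-trans (dilate-⋆ c (κ ½) X) (⋆-cong (dilate-κ c ½) (dilate-X c)))
                                                          (≈ₛ-trans (dilate-⊕ c (exp 1ℚ) 1ₛ) (⊕-cong (dilate-exp-1 c) (dilate-κ c 1ℚ))) ⟩
    κ ½ ⋆ (κ c ⋆ X) ⋆ (exp c ⊕ 1ₛ)              ∎
    where
    open ≈ₛ-Reasoning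
    dilate-E : dilate c E ≈ₛ exp c ⊕ ⊝ 1ₛ
    dilate-E = ≈ₛ-trans (dilate-cong c E≈exp-1)
                 (≈ₛ-trans (dilate-⊕ c (exp 1ℚ) (⊝ 1ₛ)) (⊕-cong (dilate-exp-1 c) (≈ₛ-trans (dilate-⊝ c 1ₛ) (⊝-cong (dilate-κ c 1ℚ)))))

  [e²ˣ+1]⋆tanh : (exp (fromℕ 2) ⊕ 1ₛ) ⋆ tanh ≈ₛ exp (fromℕ 2) ⊕ ⊝ 1ₛ
  [e²ˣ+1]⋆tanh = begin
    (exp (fromℕ 2) ⊕ 1ₛ) ⋆ tanh                 ≈⟨ ⋆-congʳ tanh (⊕-cong (exp-+ 1ℚ 1ℚ) (exp⋆exp-neg 1ℚ)) ⟨
    (e ⋆ e ⊕ e ⋆ m) ⋆ tanh                      ≈⟨ solve 3 (λ e m t → (e :* e :+ e :* m) :* t := (con (fromℕ 2) :* e) :* (con ½ :* (e :+ m) :* t))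
                                                        (λ _ → refl) e m tanh ⟩
    κ (fromℕ 2) ⋆ e ⋆ (κ ½ ⋆ (e ⊕ m) ⋆ tanh)    ≈⟨ ⋆-congˡ (κ (fromℕ 2) ⋆ e) (⋆-congʳ tanh (cosh≈exp 1ℚ)) ⟨
    κ (fromℕ 2) ⋆ e ⋆ (cosh 1ℚ ⋆ tanh)          ≈⟨ ⋆-congˡ (κ (fromℕ 2) ⋆ e) (≈ₛ-trans cosh⋆tanh≈sinh (sinh≈exp 1ℚ)) ⟩
    κ (fromℕ 2) ⋆ e ⋆ (κ ½ ⋆ (e ⊕ ⊝ m))         ≈⟨ solve 2 (λ e m → (con (fromℕ 2) :* e) :* (con ½ :* (e :- m)) := e :* e :- e :* m)
                                                        (λ _ → refl) e m ⟩
    e ⋆ e ⊕ ⊝ (e ⋆ m)                           ≈⟨ ⊕-cong (exp-+ 1ℚ 1ℚ) (⊝-cong (exp⋆exp-neg 1ℚ)) ⟩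
    exp (fromℕ 2) ⊕ ⊝ 1ₛ                        ∎
    where
    open ≈ₛ-Reasoning
    open SeriesSolver
    e m : Ser
    e = exp 1ℚ
    m = exp (- 1ℚ)

  e²ˣ γ[2x] γ[4x] : Ser
  e²ˣ   = exp (fromℕ 2)
  γ[2x] = dilate (fromℕ 2) γ
  γ[4x] = dilate (fromℕ 4) γ

  [e⁴ˣ-1]⋆γ[4x] : (e²ˣ ⋆ e²ˣ ⊕ ⊝ 1ₛ) ⋆ γ[4x] ≈ₛ κ ½ ⋆ (κ (fromℕ 4) ⋆ X) ⋆ (e²ˣ ⋆ e²ˣ ⊕ 1ₛ)
  [e⁴ˣ-1]⋆γ[4x] = begin
    (e²ˣ ⋆ e²ˣ ⊕ ⊝ 1ₛ) ⋆ γ[4x]                      ≈⟨ ⋆-congʳ γ[4x] (⊕-congʳ (⊝ 1ₛ) e²ˣ⋆e²ˣ≈e⁴ˣ) ⟩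
    (exp (fromℕ 4) ⊕ ⊝ 1ₛ) ⋆ γ[4x]                  ≈⟨ dilated-E⋆γ (fromℕ 4) ⟩
    κ ½ ⋆ (κ (fromℕ 4) ⋆ X) ⋆ (exp (fromℕ 4) ⊕ 1ₛ)  ≈⟨ ⋆-congˡ (κ ½ ⋆ (κ (fromℕ 4) ⋆ X)) (⊕-congʳ 1ₛ e²ˣ⋆e²ˣ≈e⁴ˣ) ⟨
    κ ½ ⋆ (κ (fromℕ 4) ⋆ X) ⋆ (e²ˣ ⋆ e²ˣ ⊕ 1ₛ)      ∎
    where
    open ≈ₛ-Reasoning
    e²ˣ⋆e²ˣ≈e⁴ˣ : e²ˣ ⋆ e²ˣ ≈ₛ exp (fromℕ 4)
    e²ˣ⋆e²ˣ≈e⁴ˣ = exp-+ (fromℕ 2) (fromℕ 2)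

  [e⁴ˣ-1]⋆[X⋆tanh-γ[4x]+γ[2x]]≈0 : (e²ˣ ⋆ e²ˣ ⊕ ⊝ 1ₛ) ⋆ (X ⋆ tanh ⊕ ⊝ (γ[4x] ⊕ ⊝ γ[2x])) ≈ₛ 0ₛ
  [e⁴ˣ-1]⋆[X⋆tanh-γ[4x]+γ[2x]]≈0 = begin
    (u ⋆ u ⊕ ⊝ 1ₛ) ⋆ (X ⋆ tanh ⊕ ⊝ (γ[4x] ⊕ ⊝ γ[2x]))
      ≈⟨ solve 5 (λ u x t g4 g2 → (u :* u :- con 1ℚ) :* (x :* t :- (g4 :- g2))
                   := x :* (u :- con 1ℚ) :* ((u :+ con 1ℚ) :* t) :- (u :* u :- con 1ℚ) :* g4 :+ (u :+ con 1ℚ) :* ((u :- con 1ℚ) :* g2))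
                 (λ _ → refl) u X tanh γ[4x] γ[2x] ⟩
    X ⋆ (u ⊕ ⊝ 1ₛ) ⋆ ((u ⊕ 1ₛ) ⋆ tanh) ⊕ ⊝ ((u ⋆ u ⊕ ⊝ 1ₛ) ⋆ γ[4x]) ⊕ (u ⊕ 1ₛ) ⋆ ((u ⊕ ⊝ 1ₛ) ⋆ γ[2x])
      ≈⟨ ⊕-cong (⊕-cong (⋆-congˡ (X ⋆ (u ⊕ ⊝ 1ₛ)) [e²ˣ+1]⋆tanh) (⊝-cong [e⁴ˣ-1]⋆γ[4x]))
                (⋆-congˡ (u ⊕ 1ₛ) (dilated-E⋆γ (fromℕ 2))) ⟩
    X ⋆ (u ⊕ ⊝ 1ₛ) ⋆ (u ⊕ ⊝ 1ₛ) ⊕ ⊝ (κ ½ ⋆ (κ (fromℕ 4) ⋆ X) ⋆ (u ⋆ u ⊕ 1ₛ))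
      ⊕ (u ⊕ 1ₛ) ⋆ (κ ½ ⋆ (κ (fromℕ 2) ⋆ X) ⋆ (u ⊕ 1ₛ))
      ≈⟨ solve 2 (λ u x → x :* (u :- con 1ℚ) :* (u :- con 1ℚ) :- con ½ :* (con (fromℕ 4) :* x) :* (u :* u :+ con 1ℚ)
                           :+ (u :+ con 1ℚ) :* (con ½ :* (con (fromℕ 2) :* x) :* (u :+ con 1ℚ)) := con 0ℚ)
                 (λ _ → refl) u X ⟩
    κ 0ℚ
      ≈⟨ (λ { zero → refl ; (suc n) → refl }) ⟩
    0ₛ
      ∎
    where
    open ≈ₛ-Reasoning
    open SeriesSolver
    u = e²ˣ

  X⋆tanh≈γ[4x]-γ[2x] : X ⋆ tanh ≈ₛ γ[4x] ⊕ ⊝ γ[2x]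
  X⋆tanh≈γ[4x]-γ[2x] n = difference-vanishes (difference≈0 n)
    where
    open ≈ₛ-Reasoning
    P W : Ser
    P = shift (e²ˣ ⋆ e²ˣ ⊕ ⊝ 1ₛ)
    W = X ⋆ tanh ⊕ ⊝ (γ[4x] ⊕ ⊝ γ[2x])
    difference≈0 : W ≈ₛ 0ₛ
    difference≈0 = ⋆-cancel-unit P W ¼ refl (X⋆-cancel (P ⋆ W) (begin
      X ⋆ (P ⋆ W)                ≈⟨ ⋆-assoc X P W ⟨
      X ⋆ P ⋆ W                  ≈⟨ ⋆-congʳ W (X⋆shift (e²ˣ ⋆ e²ˣ ⊕ ⊝ 1ₛ) refl) ⟨
      (e²ˣ ⋆ e²ˣ ⊕ ⊝ 1ₛ) ⋆ W     ≈⟨ [e⁴ˣ-1]⋆[X⋆tanh-γ[4x]+γ[2x]]≈0 ⟩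
      0ₛ                         ∎))
    difference-vanishes : ∀ {x y} → x + - y ≡ 0ℚ → x ≡ y
    difference-vanishes {x} {y} x-y≡0 = trans (split x y) (trans (cong (_+ y) x-y≡0) (ℚ.+-identityˡ y))
      where
      split : ∀ x y → x ≡ (x + - y) + y
      split = solve-∀ ℚ-ring

  tanh-odd : ∀ k → tanh (suc (dbl k)) ≡ (fromℕ 4 ^ℚ dbl (suc k) + - fromℕ 2 ^ℚ dbl (suc k)) * b (dbl (suc k))
  tanh-odd k = begin
    tanh (suc (dbl k))                              ≡⟨ X⋆f-suc tanh (suc (dbl k)) ⟨
    (X ⋆ tanh) (dbl (suc k))                        ≡⟨ X⋆tanh≈γ[4x]-γ[2x] (dbl (suc k)) ⟩
    p₄ * γ (dbl (suc k)) + - (p₂ * γ (dbl (suc k))) ≡⟨ cong (λ g → p₄ * g + - (p₂ * g)) γ-even ⟩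
    p₄ * β + - (p₂ * β)                             ≡⟨ factor p₄ p₂ β ⟩
    (p₄ + - p₂) * β                                 ∎
    where
    open ≡-Reasoning
    p₄ = fromℕ 4 ^ℚ dbl (suc k)
    p₂ = fromℕ 2 ^ℚ dbl (suc k)
    β  = b (dbl (suc k))
    γ-even : γ (dbl (suc k)) ≡ β
    γ-even = trans (cong (β +_) (trans (κ⋆f≡c*f ½ X (dbl (suc k))) (ℚ.*-zeroʳ ½))) (ℚ.+-identityʳ β)
    factor : ∀ x y z → x * z + - (y * z) ≡ (x + - y) * z
    factor = solve-∀ ℚ-ring

  even-coefficient : ℕ → ℚ
  even-coefficient n = fromℕ 4 * sign n * fromℕ (suc (dbl n) !) * (fromℕ 4 * fromℕ 4 ^ℚ n + - 1ℚ) * b (dbl (suc n))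

  tanForm-even≡even-coefficient : ∀ n → tanForm a (dbl n) ≡ even-coefficient n
  tanForm-even≡even-coefficient n = begin
    tanForm a (dbl n)                                            ≡⟨ tanForm-even n ⟩
    T n * ¼ ^ℚ n                                                 ≡⟨ cong (_* ¼ ^ℚ n) (T≡±[2m+1]!*tanh n) ⟩
    s * (F * tanh (suc (dbl n))) * ¼ ^ℚ n                        ≡⟨ cong (λ t → s * (F * t) * ¼ ^ℚ n) (tanh-odd n) ⟩
    s * (F * ((p₄ + - p₂) * β)) * ¼ ^ℚ n                         ≡⟨ cong₂ (λ x y → s * (F * ((x + - y) * β)) * ¼ ^ℚ n) p₄≡16P² p₂≡4P ⟩
    s * (F * ((fromℕ 4 * fromℕ 4 * (P * P) + - (fromℕ 4 * P)) * β)) * ¼ ^ℚ n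
      ≡⟨ regroup s F P β (¼ ^ℚ n) ⟩
    even-coefficient n * (¼ ^ℚ n * P)                            ≡⟨ cong (even-coefficient n *_) ¼ⁿ*4ⁿ≡1 ⟩
    even-coefficient n * 1ℚ                                      ≡⟨ ℚ.*-identityʳ _ ⟩
    even-coefficient n                                           ∎
    where
    open ≡-Reasoning
    s = sign n
    F = fromℕ (suc (dbl n) !)
    P = fromℕ 4 ^ℚ n
    β = b (dbl (suc n))
    p₄ = fromℕ 4 ^ℚ dbl (suc n)
    p₂ = fromℕ 2 ^ℚ dbl (suc n)
    p₄≡16P² : p₄ ≡ fromℕ 4 * fromℕ 4 * (P * P)
    p₄≡16P² = trans (^ℚ-dbl (fromℕ 4) (suc n)) (cong (fromℕ 4 * fromℕ 4 *_) (^ℚ-distrib-* (fromℕ 4) (fromℕ 4) n))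
    p₂≡4P : p₂ ≡ fromℕ 4 * P
    p₂≡4P = ^ℚ-dbl (fromℕ 2) (suc n)
    ¼ⁿ*4ⁿ≡1 : ¼ ^ℚ n * P ≡ 1ℚ
    ¼ⁿ*4ⁿ≡1 = trans (sym (^ℚ-distrib-* ¼ (fromℕ 4) n)) (1^ℚn≡1 n)
    regroup : ∀ s F P β q → s * (F * ((fromℕ 4 * fromℕ 4 * (P * P) + - (fromℕ 4 * P)) * β)) * q
                            ≡ fromℕ 4 * s * F * (fromℕ 4 * P + - 1ℚ) * β * (q * P)
    regroup = solve-∀ ℚ-ring

  bernForm-even≡even-coefficient : ∀ n → bernForm b (dbl n) ≡ even-coefficient n
  bernForm-even≡even-coefficient n = begin
    bernForm b (dbl n)
      ≡⟨ unfold ⟩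
    fromℕ 2 * (fromℕ (2 ℕ.^ (2 ℕ.* n ℕ.+ 2)) + - 1ℚ) * s * ι * bernoulliNumber b (2 ℕ.* n ℕ.+ 2)
      ≡⟨ cong₂ (λ x y → fromℕ 2 * (x + - 1ℚ) * s * ι * y) 2^[2n+2]≡4*4ⁿ [2n+2]!*b≡2*[1+n]*[2n+1]!*b ⟩
    fromℕ 2 * (fromℕ 4 * P + - 1ℚ) * s * ι * (fromℕ 2 * fromℕ (suc n) * F * β)
      ≡⟨ regroup s F P β ι (fromℕ (suc n)) ⟩
    even-coefficient n * (ι * fromℕ (suc n))
      ≡⟨ cong (even-coefficient n *_) (1/n*n≡1 (suc n)) ⟩
    even-coefficient n * 1ℚ
      ≡⟨ ℚ.*-identityʳ _ ⟩
    even-coefficient n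
      ∎
    where
    open ≡-Reasoning
    s = sign n
    F = fromℕ (suc (dbl n) !)
    P = fromℕ 4 ^ℚ n
    β = b (dbl (suc n))
    ι = ℤ.+ 1 / suc n
    unfold : bernForm b (dbl n) ≡ fromℕ 2 * (fromℕ (2 ℕ.^ (2 ℕ.* n ℕ.+ 2)) + - 1ℚ) * s * ι * bernoulliNumber b (2 ℕ.* n ℕ.+ 2)
    unfold rewrite evenN-dbl n | half-dbl n = refl
    2n+2≡dbl[1+n] : 2 ℕ.* n ℕ.+ 2 ≡ dbl (suc n)
    2n+2≡dbl[1+n] = trans (ℕ.+-comm (2 ℕ.* n) 2) (cong (λ m → suc (suc m)) (sym (dbl≡2* n)))
    2^[2n+2]≡4*4ⁿ : fromℕ (2 ℕ.^ (2 ℕ.* n ℕ.+ 2)) ≡ fromℕ 4 * P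
    2^[2n+2]≡4*4ⁿ = trans (cong (λ m → fromℕ (2 ℕ.^ m)) 2n+2≡dbl[1+n]) (trans (fromℕ-^ 2 (dbl (suc n))) (^ℚ-dbl (fromℕ 2) (suc n)))
    [2n+2]!*b≡2*[1+n]*[2n+1]!*b : bernoulliNumber b (2 ℕ.* n ℕ.+ 2) ≡ fromℕ 2 * fromℕ (suc n) * F * β
    [2n+2]!*b≡2*[1+n]*[2n+1]!*b = begin
      fromℕ ((2 ℕ.* n ℕ.+ 2) !) * b (2 ℕ.* n ℕ.+ 2)   ≡⟨ cong (λ m → fromℕ (m !) * b m) 2n+2≡dbl[1+n] ⟩
      fromℕ (dbl (suc n) ℕ.* suc (dbl n) !) * β       ≡⟨ cong (_* β) (fromℕ-* (dbl (suc n)) (suc (dbl n) !)) ⟩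
      fromℕ (dbl (suc n)) * F * β                     ≡⟨ cong (λ x → x * F * β) (trans (cong fromℕ (dbl≡2* (suc n))) (fromℕ-* 2 (suc n))) ⟩
      fromℕ 2 * fromℕ (suc n) * F * β                 ∎
    regroup : ∀ s F P β ι d → fromℕ 2 * (fromℕ 4 * P + - 1ℚ) * s * ι * (fromℕ 2 * d * F * β)
                              ≡ fromℕ 4 * s * F * (fromℕ 4 * P + - 1ℚ) * β * (ι * d)
    regroup = solve-∀ ℚ-ring

  tanForm≡bernForm : ∀ i → tanForm a i ≡ bernForm b i
  tanForm≡bernForm i = by-parity i (parity i)
    where
    by-parity : ∀ i → Parity i → tanForm a i ≡ bernForm b i
    by-parity _ (odd n) rewrite evenN-suc-dbl n = refl
    by-parity _ (even n) = trans (tanForm-even≡even-coefficient n) (sym (bernForm-even≡even-coefficient n))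

module EvenInT where

  open import Data.Nat using (suc)
  open import Data.Rational using (½; -½; _*_)
  import Data.Rational.Properties as ℚ
  open import Relation.Binary.PropositionalEquality
  open Rationals using (^ℚ-dbl)
  open Parity
  open Walks using (count-parity; walkCount≡count)

  walkCount-odd-to-axis : ∀ t i → walkCount (suc (dbl t)) i 0 ≡ 0
  walkCount-odd-to-axis t i = trans (walkCount≡count (suc (dbl t)) i 0) (count-parity (suc (dbl t)) 0 0 i 0 (evenN-suc-dbl t))

  QTerm-½≡QTerm-−½ : ∀ i n → QTerm ½ i n ≡ QTerm -½ i n
  QTerm-½≡QTerm-−½ i n = by-parity n (parity n)
    where
    by-parity : ∀ n → Parity n → QTerm ½ i n ≡ QTerm -½ i n
    by-parity _ (even t) = cong (fromℕ (walkCount (dbl t) i 0) *_) (trans (^ℚ-dbl ½ t) (sym (^ℚ-dbl -½ t)))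
    by-parity _ (odd t) rewrite walkCount-odd-to-axis t i =
      trans (ℚ.*-zeroˡ (½ ^ℚ suc (dbl t))) (sym (ℚ.*-zeroˡ (-½ ^ℚ suc (dbl t))))

open Convergence using (SeriesConvergesTo-cong)
open EvenInT using (QTerm-½≡QTerm-−½)

theorem1p3 : (a : ℕ → ℚ) → IsTanSeries a → (b : ℕ → ℚ) → IsBernoulliEGF b →
    (∀ (i : ℕ) → SeriesConvergesTo (QTerm ½ i) (tanForm a i))
    × (∀ (i : ℕ) → SeriesConvergesTo (QTerm -½ i) (tanForm a i))
    × (∀ (i : ℕ) → SeriesConvergesTo (QTerm ½ i) (bernForm b i))
theorem1p3 a a-tan b b-bern = at-½ , at-−½ , via-bernoulli
  where
  open GreenFunction a a-tan using (green-on-axis)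
  open WalkSeries a a-tan using (green-series)
  open TangentBernoulli a a-tan b b-bern using (tanForm≡bernForm)
  at-½ : ∀ i → SeriesConvergesTo (QTerm ½ i) (tanForm a i)
  at-½ i = subst (SeriesConvergesTo (QTerm ½ i)) (green-on-axis i) (green-series i)
  at-−½ : ∀ i → SeriesConvergesTo (QTerm -½ i) (tanForm a i)
  at-−½ i = SeriesConvergesTo-cong (QTerm-½≡QTerm-−½ i) (at-½ i)
  via-bernoulli : ∀ i → SeriesConvergesTo (QTerm ½ i) (bernForm b i)
  via-bernoulli i = subst (SeriesConvergesTo (QTerm ½ i)) (tanForm≡bernForm i) (at-½ i)
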